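{- A function $f\colon[0,1]\to\mathbb{R}$ has a continuous modulus if and only if $f$ is induced by a code of a continuous function.
   Context: The setting is constructive. Reals and moduli: - Real numbers are regular sequences of rationals $\langle r_n\rangle$ with $|r_n-r_{n+1}|\le2^{ -(n+1)}$, with equality $\langle r_n\rangle\simeq\langle q_n\rangle$ iff $\forall n\,|r_{n+1}-q_{n+1}|\le2^{ -n}$. Functions $[0,1]\to\mathbb{R}$ respect $\simeq$. - Fix a bijective coding of $\mathbb{Q}$ by $\mathbb{N}$. Let $|[0,1]|$ be the set of regular sequences in $[0,1]$, viewed as a subset of $\mathbb{N}^{\mathbb{N}}$ with pointwise equality (not $\simeq$). - A modulus of $f$ is $g\colon\mathbb{N}\to|[0,1]|\to\mathbb{N}$ with $\forall k\,\forall x,y\in[0,1]\,(|x-y|\le2^{ -g_k(x)}\to|f(x)-f(y)|\le2^{ -k})$. It is continuous if each $g_k$ is pointwise continuous: $\forall x\,\exists n\,\forall y\,(\overline{x}n=\overline{y}n\to g_k(x)=g_k(y))$. Ternary tree: - For $s\in\{0,1,2\}^*$, define $N(\langle\rangle)=1$ and $N(s*\langle i\rangle)=2N(s)+(i-1)$. - For $\alpha\in\{0,1,2\}^{\mathbb{N}}$, $\Phi(\alpha)=\langle2^{ -(n+1)}N(\overline{\alpha}n)\rangle_n$. - For $s\in\{0,1,2\}^*$, $\mathbb{I}_s=(2^{ -(|s|+1)}(N(s)-1),\,2^{ -(|s|+1)}(N(s)+1))$. Rational intervals: - $\mathbb{T}=\{(p,q)\in\mathbb{Q}^2:p\le q\}$,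 identified with a subset of $\mathbb{N}$ via a fixed coding. - For $I=(p,q)$: $|I|=q-p$. - $(p,q)\sqsubseteq(p',q')$ iff $p'\le p$ and $q\le q'$. - $(p,q)\approx(p',q')$ iff $p'\le q$ and $p\le q'$. - $\dot-$ is truncated subtraction. Codes: - A code of a continuous function is $\varphi\colon\{0,1,2\}^*\to\mathbb{N}$ such that: (C1) $\varphi(s)\ne0\to\varphi(s)\dot-1\in\mathbb{T}$; (C2) $\forall k\,\forall\alpha\,\exists n\,(\varphi(\overline{\alpha}n)\ne0\wedge|\varphi(\overline{\alpha}n)\dot-1|\le2^{ -k})$; (C3) for all $s$ and $i\in\{0,1,2\}$, $\varphi(s)\ne0\to(\varphi(s*\langle i\rangle)\ne0\wedge\varphi(s*\langle i\rangle)\dot-1\sqsubseteq\varphi(s)\dot-1)$; (C4) for all $s,t$, $(\varphi(s)\ne0\wedge\varphi(t)\ne0\wedge\mathbb{I}_s\approx\mathbb{I}_t)\to\varphi(s)\dot-1\approx\varphi(t)\dot-1$. - For a code $\varphi$, let $h_k(\alpha)$ be the least $n$ with $\varphi(\overline{\alpha}n)\ne0$ and $|\varphi(\overline{\alpha}n)\dot-1|\le2^{ -k}$. Let $f^\varphi_T(\alpha)=\langle\varphi(\overline{\alpha}h_n(\alpha))\dot-1\rangle_n$. This is a shrinking sequence of intervals $\langle\mathbb{J}_n\rangle$: $\mathbb{J}_{n+1}\sqsubseteq\mathbb{J}_n$ and $\forall k\,\exists n\,|\mathbb{J}_n|\le2^{ -k}$. - A shrinking sequence determines the real number $\langle\text{left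 endpoint of }\mathbb{J}_{\delta(n)}\rangle_n$, where $\delta(k)$ is the least $n$ with $|\mathbb{J}_n|\le2^{ -(k+1)}$. - $f$ is induced by $\varphi$ if for every $\alpha\in\{0,1,2\}^{\mathbb{N}}$, $f(\Phi(\alpha))$ equals the real number determined by $f^\varphi_T(\alpha)$. -}

module Defs where

open import Data.Nat as ℕ using (ℕ; zero; suc)
open import Data.Integer using (+_)
open import Data.Rational using (ℚ; 0ℚ; 1ℚ; ½; _/_; _+_; _-_; _*_; ∣_∣; _≤_)
open import Data.Fin using (Fin; toℕ)
open import Data.List using (List; []; _∷_; _++_; foldl; applyUpTo; length)
open import Data.Maybe using (Maybe; just; nothing)
open import Data.Product using (Σ; _×_; _,_; proj₁; proj₂)
open import Relation.Binary.PropositionalEquality using (_≡_)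

half : ℕ → ℚ
half zero    = 1ℚ
half (suc n) = ½ * half n

Seq : Set
Seq = ℕ → ℚ

Regular : Seq → Set
Regular r = ∀ n → ∣ r n - r (suc n) ∣ ≤ half (suc n)

_≃_ : Seq → Seq → Set
r ≃ q = ∀ n → ∣ r (suc n) - q (suc n) ∣ ≤ half n

ℝ : Set
ℝ = Σ Seq Regular

InUnit : Seq → Set
InUnit r = ∀ n → (0ℚ ≤ r n) × (r n ≤ 1ℚ)

UnitReal : Set
UnitReal = Σ Seq (λ r → Regular r × InUnit r)

Respects : (UnitReal → ℝ) → Set
Respects f = ∀ x y → proj₁ x ≃ proj₁ y → proj₁ (f x) ≃ proj₁ (f y)

-- |x - y| ≤ 2^{-m} for reals given by regular sequences x, y
-- (since |x_n - x| ≤ 2^{-n}, this holds iff ∀ n |x_n - y_n| ≤ 2^{-m} + 2·2^{-n})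
DistLe : Seq → Seq → ℕ → Set
DistLe x y m = ∀ n → ∣ x n - y n ∣ ≤ half m + (half n + half n)

AgreeUpTo : Seq → Seq → ℕ → Set
AgreeUpTo x y n = ∀ i → i ℕ.< n → x i ≡ y i

IsModulus : (UnitReal → ℝ) → (ℕ → UnitReal → ℕ) → Set
IsModulus f g = ∀ k (x y : UnitReal) →
  DistLe (proj₁ x) (proj₁ y) (g k x) →
  DistLe (proj₁ (f x)) (proj₁ (f y)) k

PointwiseContinuous : (UnitReal → ℕ) → Set
PointwiseContinuous G = ∀ (x : UnitReal) → Σ ℕ λ n → ∀ (y : UnitReal) →
  AgreeUpTo (proj₁ x) (proj₁ y) n → G x ≡ G y

HasContinuousModulus : (UnitReal → ℝ) → Set
HasContinuousModulus f = Σ (ℕ → UnitReal → ℕ) λ g →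
  IsModulus f g × (∀ k → PointwiseContinuous (g k))

Ter : Set
Ter = Fin 3

init : (ℕ → Ter) → ℕ → List Ter
init α n = applyUpTo α n

-- N(⟨⟩) = 1, N(s * ⟨i⟩) = 2 N(s) + (i - 1)   (never negative since N(s) ≥ 1)
N : List Ter → ℕ
N s = foldl (λ acc i → 2 ℕ.* acc ℕ.+ toℕ i ℕ.∸ 1) 1 s

ℕtoℚ : ℕ → ℚ
ℕtoℚ n = + n / 1

Φ : (ℕ → Ter) → Seq
Φ α n = half (suc n) * ℕtoℚ (N (init α n))

-- Rational intervals (pairs (p , q); membership in 𝕋 means p ≤ q)

Interval : Set
Interval = ℚ × ℚ

left : Interval → ℚ
left = proj₁

width : Interval → ℚ
width (p , q) = q - p

_⊑_ : Interval → Interval → Set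
(p , q) ⊑ (p' , q') = (p' ≤ p) × (q ≤ q')

_≈I_ : Interval → Interval → Set
(p , q) ≈I (p' , q') = (p' ≤ q) × (p ≤ q')

InT : Interval → Set
InT (p , q) = p ≤ q

𝕀 : List Ter → Interval
𝕀 s = ( half (suc (length s)) * (ℕtoℚ (N s) - 1ℚ)
      , half (suc (length s)) * (ℕtoℚ (N s) + 1ℚ) )

-- Codes.  φ(s) = 0 is rendered as `nothing`, φ(s) ≠ 0 with φ(s) ∸ 1 = I
-- is rendered as `just I`.

Code : Set
Code = List Ter → Maybe Interval

C1 : Code → Set
C1 φ = ∀ s I → φ s ≡ just I → InT I

Fine : Code → List Ter → ℕ → Set
Fine φ s k = Σ Interval λ I → (φ s ≡ just I) × (width I ≤ half k)

C2 : Code → Set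
C2 φ = ∀ k (α : ℕ → Ter) → Σ ℕ λ n → Fine φ (init α n) k

C3 : Code → Set
C3 φ = ∀ s (i : Ter) I → φ s ≡ just I →
  Σ Interval λ I' → (φ (s ++ (i ∷ [])) ≡ just I') × (I' ⊑ I)

C4 : Code → Set
C4 φ = ∀ s t I J → φ s ≡ just I → φ t ≡ just J → 𝕀 s ≈I 𝕀 t → I ≈I J

IsCode : Code → Set
IsCode φ = C1 φ × C2 φ × C3 φ × C4 φ

IsLeast : (ℕ → Set) → ℕ → Set
IsLeast P n = P n × (∀ m → m ℕ.< n → P m → Data.Empty.⊥)
  where import Data.Empty

IsH : Code → (ℕ → Ter) → (ℕ → ℕ) → Set
IsH φ α h = ∀ k → IsLeast (λ n → Fine φ (init α n) k) (h k)

IsFT : Code → (ℕ → Ter) → (ℕ → ℕ) → (ℕ → Interval) → Set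
IsFT φ α h J = ∀ n → φ (init α (h n)) ≡ just (J n)

IsDelta : (ℕ → Interval) → (ℕ → ℕ) → Set
IsDelta J δ = ∀ k → IsLeast (λ n → width (J n) ≤ half (suc k)) (δ k)

determined : (ℕ → Interval) → (ℕ → ℕ) → Seq
determined J δ n = left (J (δ n))

InducedBy : Code → (UnitReal → ℝ) → Set
InducedBy φ f = ∀ (α : ℕ → Ter) (x : UnitReal) → (∀ n → proj₁ x n ≡ Φ α n) →
  ∀ h J δ → IsH φ α h → IsFT φ α h J → IsDelta J δ →
  proj₁ (f x) ≃ determined J δ

-- From a continuous modulus g to a code: let x_s be the centre of the cell 𝕀_s.
-- Once g_k(x_s) ≤ |s|, every y within 2^{-|s|} of x_s has f(y) within 2·2^{-k}
-- of f(x_s)_k.  Intersecting these intervals along the prefixes of s gives φ(s),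
-- which encloses f on a whole neighbourhood of the cell; continuity of g_k makes
-- the intervals eventually narrow (C2), and overlapping cells share a point
-- whose image lies in both intervals (C4).
--
-- From a code to a modulus: every x ∈ [0,1] is followed down the tree, the next
-- digit being chosen from the rational x_{n+5} so that the n-th cell contains
-- the ball of radius 2^{-(n+3)} around x (cut off at 0 and 1).  Since f maps a
-- cell t into φ(t), g_k(x) = 3 + h_k(digits of x) is a modulus, and it is
-- continuous because the first n digits depend only on x_0, …, x_{n+4}.

module Submission where

open import Defs
open import Function using (case_of_)
open import Function.Bundles using (_⇔_; mk⇔)
open import Data.Nat as ℕ using (ℕ; zero; suc)
import Data.Nat.Properties as NP
open import Data.Nat.Coprimality using (Coprime)
import Data.Integer as ℤ
import Data.Integer.Solver as ℤSolver
open import Data.Fin as F using (toℕ)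
open import Data.List using (List; []; _∷_; _++_; foldl; length)
import Data.List.Properties as LP
open import Data.Maybe using (Maybe; just; nothing)
open import Data.Maybe.Properties using (just-injective)
open import Data.Rational as Q
  using (ℚ; 0ℚ; 1ℚ; ½; _+_; _-_; _*_; -_; ∣_∣; _≤_; _<_; _⊔_; _⊓_; mkℚ; NonNegative; Positive; *≤*; *<*)
open import Data.Rational.Properties
import Data.Rational.Unnormalised as U
import Data.Rational.Unnormalised.Properties as UP
open import Data.Rational.Solver
open +-*-Solver
open import Data.Product using (Σ; _×_; _,_; proj₁; proj₂)
open import Data.Sum using (_⊎_; inj₁; inj₂)
open import Data.Empty using (⊥; ⊥-elim)
open import Relation.Nullary using (yes; no; Dec)
open import Relation.Nullary.Decidable using (map′)
open import Relation.Binary.PropositionalEquality using (_≡_; refl; sym; trans; cong; cong₂; subst; subst₂; module ≡-Reasoning)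
open import Relation.Binary.Definitions using (tri<; tri≈; tri>)

module ℤS = ℤSolver.+-*-Solver

-- Linear inequalities over ℚ are proved by adding up known ones with _⊕_ into
-- L ≤ R and letting the ring solver check A + R ≡ B + L.
≤-from-sum : ∀ {A B L R} → L ≤ R → A + R ≡ B + L → A ≤ B
≤-from-sum {A} {B} {L} {R} L≤R eq = begin
  A           ≡⟨ solve 2 (λ a l → a := (a :+ l) :- l) refl A L ⟩
  (A + L) - L ≤⟨ +-monoˡ-≤ (- L) (+-monoʳ-≤ A L≤R) ⟩
  (A + R) - L ≡⟨ cong (_- L) eq ⟩
  (B + L) - L ≡⟨ solve 2 (λ b l → (b :+ l) :- l := b) refl B L ⟩
  B           ∎
  where open ≤-Reasoning

infixl 6 _⊕_
_⊕_ : ∀ {a b c d} → a ≤ b → c ≤ d → a + c ≤ b + d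
_⊕_ = +-mono-≤

0≤1 : 0ℚ ≤ 1ℚ
0≤1 = *≤* (ℤ.+≤+ ℕ.z≤n)

≤-+-nonNeg : ∀ {a} b → 0ℚ ≤ b → a ≤ a + b
≤-+-nonNeg {a} b 0≤b = ≤-from-sum 0≤b (sym (+-identityʳ (a + b)))

-‿nonNeg-≤ : ∀ {a} b → 0ℚ ≤ b → a - b ≤ a
-‿nonNeg-≤ {a} b 0≤b = ≤-from-sum 0≤b (solve 2 (λ a b → (a :- b) :+ b := a :+ con 0ℚ) refl a b)

*-nonNeg : ∀ {a b} → 0ℚ ≤ a → 0ℚ ≤ b → 0ℚ ≤ a * b
*-nonNeg {a} 0≤a 0≤b = ≤-trans (≤-reflexive (sym (*-zeroʳ a))) (*-monoˡ-≤-nonNeg a {{Q.nonNegative 0≤a}} 0≤b)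

half-nonNeg : ∀ n → 0ℚ ≤ half n
half-nonNeg zero    = 0≤1
half-nonNeg (suc n) = *-nonNeg {½} (*≤* (ℤ.+≤+ ℕ.z≤n)) (half-nonNeg n)

half-pos : ∀ n → 0ℚ < half n
half-pos zero    = *<* (ℤ.+<+ (ℕ.s≤s ℕ.z≤n))
half-pos (suc n) = <-respˡ-≡ refl (*-monoʳ-<-pos ½ (half-pos n))

half-suc+half-suc : ∀ n → half (suc n) + half (suc n) ≡ half n
half-suc+half-suc n = solve 1 (λ h → con ½ :* h :+ con ½ :* h := h) refl (half n)

half-suc≤half : ∀ n → half (suc n) ≤ half n
half-suc≤half n = ≤-trans (≤-+-nonNeg (half (suc n)) (half-nonNeg (suc n))) (≤-reflexive (half-suc+half-suc n))

half-suc<half : ∀ n → half (suc n) < half n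
half-suc<half n = <-respʳ-≡ (half-suc+half-suc n)
  (<-respˡ-≡ (+-identityˡ (half (suc n))) (+-mono-<-≤ (half-pos (suc n)) (≤-refl {half (suc n)})))

half≤1 : ∀ n → half n ≤ 1ℚ
half≤1 zero    = ≤-refl
half≤1 (suc n) = ≤-trans (half-suc≤half n) (half≤1 n)

half-antimono : ∀ {m n} → m ℕ.≤ n → half n ≤ half m
half-antimono {zero} {n} ℕ.z≤n = half≤1 n
half-antimono (ℕ.s≤s m≤n)      = *-monoˡ-≤-nonNeg ½ (half-antimono m≤n)

ℕtoℚ-suc : ∀ n → ℕtoℚ (suc n) ≡ 1ℚ + ℕtoℚ n
ℕtoℚ-suc n = toℚᵘ-injective (UP.≃-trans (toℚᵘ-fromℚᵘ (U.mkℚᵘ (ℤ.+ suc n) 0))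
  (UP.≃-sym (UP.≃-trans (toℚᵘ-homo-+ 1ℚ (ℕtoℚ n))
    (UP.≃-trans (UP.+-cong (toℚᵘ-fromℚᵘ (U.mkℚᵘ (ℤ.+ 1) 0)) (toℚᵘ-fromℚᵘ (U.mkℚᵘ (ℤ.+ n) 0)))
      (U.*≡* (ℤS.solve 1 (λ m → (ℤS.con (ℤ.+ 1) ℤS.:* ℤS.con (ℤ.+ 1) ℤS.:+ m ℤS.:* ℤS.con (ℤ.+ 1)) ℤS.:* ℤS.con (ℤ.+ 1)
                   ℤS.:= (ℤS.con (ℤ.+ 1) ℤS.:+ m) ℤS.:* (ℤS.con (ℤ.+ 1) ℤS.:* ℤS.con (ℤ.+ 1))) refl (ℤ.+ n)))))))

ℕtoℚ-+ : ∀ m n → ℕtoℚ (m ℕ.+ n) ≡ ℕtoℚ m + ℕtoℚ n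
ℕtoℚ-+ zero    n = sym (+-identityˡ (ℕtoℚ n))
ℕtoℚ-+ (suc m) n = begin
  ℕtoℚ (suc (m ℕ.+ n))     ≡⟨ ℕtoℚ-suc (m ℕ.+ n) ⟩
  1ℚ + ℕtoℚ (m ℕ.+ n)      ≡⟨ cong (1ℚ +_) (ℕtoℚ-+ m n) ⟩
  1ℚ + (ℕtoℚ m + ℕtoℚ n)   ≡⟨ sym (+-assoc 1ℚ (ℕtoℚ m) (ℕtoℚ n)) ⟩
  (1ℚ + ℕtoℚ m) + ℕtoℚ n   ≡⟨ cong (_+ ℕtoℚ n) (sym (ℕtoℚ-suc m)) ⟩
  ℕtoℚ (suc m) + ℕtoℚ n    ∎
  where open ≡-Reasoning

ℕtoℚ-* : ∀ m n → ℕtoℚ (m ℕ.* n) ≡ ℕtoℚ m * ℕtoℚ n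
ℕtoℚ-* zero    n = sym (*-zeroˡ (ℕtoℚ n))
ℕtoℚ-* (suc m) n = begin
  ℕtoℚ (n ℕ.+ m ℕ.* n)      ≡⟨ ℕtoℚ-+ n (m ℕ.* n) ⟩
  ℕtoℚ n + ℕtoℚ (m ℕ.* n)   ≡⟨ cong (ℕtoℚ n +_) (ℕtoℚ-* m n) ⟩
  ℕtoℚ n + ℕtoℚ m * ℕtoℚ n  ≡⟨ solve 2 (λ a b → b :+ a :* b := (con 1ℚ :+ a) :* b) refl (ℕtoℚ m) (ℕtoℚ n) ⟩
  (1ℚ + ℕtoℚ m) * ℕtoℚ n    ≡⟨ cong (_* ℕtoℚ n) (sym (ℕtoℚ-suc m)) ⟩
  ℕtoℚ (suc m) * ℕtoℚ n     ∎
  where open ≡-Reasoning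

ℕtoℚ-∸ : ∀ m n → n ℕ.≤ m → ℕtoℚ (m ℕ.∸ n) ≡ ℕtoℚ m - ℕtoℚ n
ℕtoℚ-∸ m n n≤m = begin
  ℕtoℚ (m ℕ.∸ n)                      ≡⟨ solve 2 (λ a b → a := (b :+ a) :- b) refl (ℕtoℚ (m ℕ.∸ n)) (ℕtoℚ n) ⟩
  (ℕtoℚ n + ℕtoℚ (m ℕ.∸ n)) - ℕtoℚ n  ≡⟨ cong (_- ℕtoℚ n) (sym (ℕtoℚ-+ n (m ℕ.∸ n))) ⟩
  ℕtoℚ (n ℕ.+ (m ℕ.∸ n)) - ℕtoℚ n     ≡⟨ cong (λ k → ℕtoℚ k - ℕtoℚ n) (NP.m+[n∸m]≡n n≤m) ⟩
  ℕtoℚ m - ℕtoℚ n                     ∎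
  where open ≡-Reasoning

ℕtoℚ-nonNeg : ∀ n → 0ℚ ≤ ℕtoℚ n
ℕtoℚ-nonNeg zero    = ≤-refl
ℕtoℚ-nonNeg (suc n) = ≤-trans (ℕtoℚ-nonNeg n)
  (≤-trans (≤-+-nonNeg 1ℚ 0≤1) (≤-reflexive (trans (+-comm (ℕtoℚ n) 1ℚ) (sym (ℕtoℚ-suc n)))))

ℕtoℚ-mono : ∀ {m n} → m ℕ.≤ n → ℕtoℚ m ≤ ℕtoℚ n
ℕtoℚ-mono {m} m≤n with NP.m≤n⇒∃[o]m+o≡n m≤n
... | k , refl = ≤-trans (≤-+-nonNeg (ℕtoℚ k) (ℕtoℚ-nonNeg k)) (≤-reflexive (sym (ℕtoℚ-+ m k)))

half*2^ : ∀ n → half n * ℕtoℚ (2 ℕ.^ n) ≡ 1ℚ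
half*2^ zero    = refl
half*2^ (suc n) = begin
  (½ * half n) * ℕtoℚ (2 ℕ.* 2 ℕ.^ n)         ≡⟨ cong ((½ * half n) *_) (ℕtoℚ-* 2 (2 ℕ.^ n)) ⟩
  (½ * half n) * (ℕtoℚ 2 * ℕtoℚ (2 ℕ.^ n))    ≡⟨ solve 2 (λ h p → (con ½ :* h) :* (con (ℕtoℚ 2) :* p) := h :* p) refl
                                                   (half n) (ℕtoℚ (2 ℕ.^ n)) ⟩
  half n * ℕtoℚ (2 ℕ.^ n)                     ≡⟨ half*2^ n ⟩
  1ℚ                                          ∎
  where open ≡-Reasoning

n<2^n : ∀ n → n ℕ.< 2 ℕ.^ n
n<2^n zero    = ℕ.s≤s ℕ.z≤n
n<2^n (suc n) = NP.≤-trans (NP.+-mono-≤ (NP.m^n>0 2 n) (n<2^n n))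
  (NP.≤-reflexive (cong (2 ℕ.^ n ℕ.+_) (sym (NP.+-identityʳ (2 ℕ.^ n)))))

mkℚ*denominator : ∀ k d-1 .(c : Coprime (suc k) (suc d-1)) → mkℚ (ℤ.+ suc k) d-1 c * ℕtoℚ (suc d-1) ≡ ℕtoℚ (suc k)
mkℚ*denominator k d-1 c = toℚᵘ-injective
  (UP.≃-trans (toℚᵘ-homo-* (mkℚ (ℤ.+ suc k) d-1 c) (ℕtoℚ (suc d-1)))
  (UP.≃-trans (UP.*-congˡ {U.mkℚᵘ (ℤ.+ suc k) d-1} (toℚᵘ-fromℚᵘ (U.mkℚᵘ (ℤ.+ suc d-1) 0)))
  (UP.≃-sym (UP.≃-trans (toℚᵘ-fromℚᵘ (U.mkℚᵘ (ℤ.+ suc k) 0))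
    (U.*≡* (ℤS.solve 2 (λ a b → a ℤS.:* (b ℤS.:* ℤS.con (ℤ.+ 1)) ℤS.:= (a ℤS.:* b) ℤS.:* ℤS.con (ℤ.+ 1))
                       refl (ℤ.+ suc k) (ℤ.+ suc d-1)))))))

half<pos : ∀ d → 0ℚ < d → Σ ℕ λ j → half j < d
half<pos (mkℚ (ℤ.+ zero) _ _) 0<d with drop-*<* 0<d
... | ℤ.+<+ ()
half<pos (mkℚ ℤ.-[1+ _ ] _ _) 0<d with drop-*<* 0<d
... | ()
half<pos d@(mkℚ (ℤ.+ suc k) d-1 c) 0<d = suc D , <-≤-trans (half-suc<half D) half-D≤d
  where
  D = suc d-1
  instance
    2^D-pos : Positive (ℕtoℚ (2 ℕ.^ D))
    2^D-pos = Q.positive (<-≤-trans (*<* (ℤ.+<+ (ℕ.s≤s ℕ.z≤n))) (ℕtoℚ-mono (NP.m^n>0 2 D)))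
    d-nonNeg : NonNegative d
    d-nonNeg = Q.nonNegative (<⇒≤ 0<d)
  half-D≤d : half D ≤ d
  half-D≤d = *-cancelʳ-≤-pos (ℕtoℚ (2 ℕ.^ D)) (begin
    half D * ℕtoℚ (2 ℕ.^ D)  ≡⟨ half*2^ D ⟩
    1ℚ                       ≤⟨ ℕtoℚ-mono {1} {suc k} (ℕ.s≤s ℕ.z≤n) ⟩
    ℕtoℚ (suc k)             ≡⟨ sym (mkℚ*denominator k d-1 c) ⟩
    d * ℕtoℚ D               ≤⟨ *-monoˡ-≤-nonNeg d (ℕtoℚ-mono (NP.<⇒≤ (n<2^n D))) ⟩
    d * ℕtoℚ (2 ℕ.^ D)       ∎)
    where open ≤-Reasoning

≤-by-halves : ∀ a b → (∀ j → a ≤ b + half j) → a ≤ b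
≤-by-halves a b a≤b+ with a ≤? b
... | yes a≤b = a≤b
... | no  a≰b with half<pos (a - b) (<-respˡ-≡ (+-inverseʳ b) (+-monoˡ-< (- b) (≰⇒> a≰b)))
...   | j , half-j<a-b = ⊥-elim (<-irrefl refl (≤-<-trans (a≤b+ j)
          (<-respʳ-≡ (solve 2 (λ a b → b :+ (a :- b) := a) refl a b) (+-monoʳ-< b half-j<a-b))))

p≤∣p∣ : ∀ p → p ≤ ∣ p ∣
p≤∣p∣ p with ∣p∣≡p∨∣p∣≡-p p
... | inj₁ ∣p∣≡p  = ≤-reflexive (sym ∣p∣≡p)
... | inj₂ ∣p∣≡-p = ≤-trans (≤-reflexive (solve 1 (λ x → x := :- (:- x)) refl p))
                      (≤-trans (neg-antimono-≤ (≤-trans (0≤∣p∣ p) (≤-reflexive ∣p∣≡-p))) (0≤∣p∣ p))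

∣p-q∣≡∣q-p∣ : ∀ p q → ∣ p - q ∣ ≡ ∣ q - p ∣
∣p-q∣≡∣q-p∣ p q = trans (cong ∣_∣ (solve 2 (λ p q → p :- q := :- (q :- p)) refl p q)) (∣-p∣≡∣p∣ (q - p))

∣p-q∣≤⇒≤ : ∀ p q {b} → ∣ p - q ∣ ≤ b → p ≤ q + b
∣p-q∣≤⇒≤ p q {b} d = ≤-from-sum (≤-trans (p≤∣p∣ (p - q)) d)
  (solve 3 (λ p q b → p :+ b := (q :+ b) :+ (p :- q)) refl p q b)

∣p-q∣≤⇒≥ : ∀ p q {b} → ∣ p - q ∣ ≤ b → q ≤ p + b
∣p-q∣≤⇒≥ p q d = ∣p-q∣≤⇒≤ q p (≤-trans (≤-reflexive (∣p-q∣≡∣q-p∣ q p)) d)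

≤⇒∣p-q∣≤ : ∀ {p q b} → p ≤ q + b → q ≤ p + b → ∣ p - q ∣ ≤ b
≤⇒∣p-q∣≤ {p} {q} {b} p≤ q≤ with ∣p∣≡p∨∣p∣≡-p (p - q)
... | inj₁ e = ≤-trans (≤-reflexive e) (≤-from-sum p≤ (solve 3 (λ p q b → (p :- q) :+ (q :+ b) := b :+ p) refl p q b))
... | inj₂ e = ≤-trans (≤-reflexive e) (≤-from-sum q≤ (solve 3 (λ p q b → (:- (p :- q)) :+ (p :+ b) := b :+ q) refl p q b))

∣p-r∣≤∣p-q∣+∣q-r∣ : ∀ p q r → ∣ p - r ∣ ≤ ∣ p - q ∣ + ∣ q - r ∣
∣p-r∣≤∣p-q∣+∣q-r∣ p q r = ≤-trans (≤-reflexive (cong ∣_∣ (solve 3 (λ p q r → p :- r := (p :- q) :+ (q :- r)) refl p q r)))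
  (∣p+q∣≤∣p∣+∣q∣ (p - q) (q - r))

telescope : (w r : ℕ → ℚ) → (∀ n → w (suc n) + w (suc n) ≡ w n) → (∀ n → ∣ r n - r (suc n) ∣ ≤ w (suc n)) →
            ∀ m k → (r (k ℕ.+ m) ≤ r m + (w m - w (k ℕ.+ m))) × (r m ≤ r (k ℕ.+ m) + (w m - w (k ℕ.+ m)))
telescope w r w-split step m zero =
  ≤-from-sum ≤-refl (solve 2 (λ x y → x :+ x := (x :+ (y :- y)) :+ x) refl (r m) (w m)) ,
  ≤-from-sum ≤-refl (solve 2 (λ x y → x :+ x := (x :+ (y :- y)) :+ x) refl (r m) (w m))
telescope w r w-split step m (suc k) =
  ≤-from-sum (subst (λ v → r K ≤ r m + (w m - v)) (sym (w-split K)) (proj₁ IH) ⊕ ∣p-q∣≤⇒≥ (r K) (r (suc K)) (step K))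
    (solve 5 (λ a b c d e → a :+ ((c :+ (d :- (e :+ e))) :+ (b :+ e)) := (c :+ (d :- e)) :+ (b :+ a)) refl
      (r (suc K)) (r K) (r m) (w m) (w (suc K))) ,
  ≤-from-sum (subst (λ v → r m ≤ r K + (w m - v)) (sym (w-split K)) (proj₂ IH) ⊕ ∣p-q∣≤⇒≤ (r K) (r (suc K)) (step K))
    (solve 5 (λ a b c d e → c :+ ((b :+ (d :- (e :+ e))) :+ (a :+ e)) := (a :+ (d :- e)) :+ (c :+ b)) refl
      (r (suc K)) (r K) (r m) (w m) (w (suc K)))
  where
  K  = k ℕ.+ m
  IH = telescope w r w-split step m k

regular-≤ : ∀ {r} → Regular r → ∀ m n → r m ≤ r n + (half m + half n)
regular-≤ {r} reg m n with NP.≤-total m n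
... | inj₁ m≤n with NP.m≤n⇒∃[o]m+o≡n m≤n
...   | k , refl = ≤-from-sum (far ⊕ half-nonNeg (m ℕ.+ k) ⊕ half-nonNeg (m ℕ.+ k))
          (solve 4 (λ a b c d → a :+ ((b :+ (c :- d)) :+ d :+ d) := (b :+ (c :+ d)) :+ ((a :+ con 0ℚ) :+ con 0ℚ)) refl
            (r m) (r (m ℕ.+ k)) (half m) (half (m ℕ.+ k)))
  where
  far : r m ≤ r (m ℕ.+ k) + (half m - half (m ℕ.+ k))
  far = subst (λ i → r m ≤ r i + (half m - half i)) (NP.+-comm k m)
          (proj₂ (telescope half r half-suc+half-suc reg m k))
regular-≤ {r} reg m n | inj₂ n≤m with NP.m≤n⇒∃[o]m+o≡n n≤m
...   | k , refl = ≤-from-sum (far ⊕ half-nonNeg (n ℕ.+ k) ⊕ half-nonNeg (n ℕ.+ k))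
          (solve 4 (λ a b c d → a :+ ((b :+ (c :- d)) :+ d :+ d) := (b :+ (d :+ c)) :+ ((a :+ con 0ℚ) :+ con 0ℚ)) refl
            (r (n ℕ.+ k)) (r n) (half n) (half (n ℕ.+ k)))
  where
  far : r (n ℕ.+ k) ≤ r n + (half n - half (n ℕ.+ k))
  far = subst (λ i → r i ≤ r n + (half n - half i)) (NP.+-comm k n)
          (proj₁ (telescope half r half-suc+half-suc reg n k))

LowerBound : Seq → ℚ → Set
LowerBound z p = ∀ n → p ≤ z n + half n

UpperBound : Seq → ℚ → Set
UpperBound z q = ∀ n → z n ≤ q + half n

infix 4 _∈ᴵ_
_∈ᴵ_ : Seq → Interval → Set
z ∈ᴵ I = LowerBound z (proj₁ I) × UpperBound z (proj₂ I)

lowerBound-weaken : ∀ {z p p'} → p' ≤ p → LowerBound z p → LowerBound z p'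
lowerBound-weaken p'≤p lb n = ≤-trans p'≤p (lb n)

upperBound-weaken : ∀ {z q q'} → q ≤ q' → UpperBound z q → UpperBound z q'
upperBound-weaken q≤q' ub n = ≤-trans (ub n) (+-monoˡ-≤ _ q≤q')

lowerBound-from-term : ∀ {z} → Regular z → ∀ {m a} → a ≤ z m → LowerBound z (a - half m)
lowerBound-from-term {z} reg {m} {a} a≤zm n = ≤-from-sum (regular-≤ {z} reg m n ⊕ a≤zm)
  (solve 5 (λ zn zm a hm hn → (a :- hm) :+ ((zn :+ (hm :+ hn)) :+ zm) := (zn :+ hn) :+ (zm :+ a)) refl
    (z n) (z m) a (half m) (half n))

upperBound-from-term : ∀ {z} → Regular z → ∀ {m a} → z m ≤ a → UpperBound z (a + half m)
upperBound-from-term {z} reg {m} {a} zm≤a n = ≤-from-sum (regular-≤ {z} reg n m ⊕ zm≤a)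
  (solve 5 (λ zn zm a hm hn → zn :+ ((zm :+ (hn :+ hm)) :+ a) := ((a :+ hm) :+ hn) :+ (zn :+ zm)) refl
    (z n) (z m) a (half m) (half n))

lower≤upper : ∀ {z p q} → LowerBound z p → UpperBound z q → p ≤ q
lower≤upper {z} {p} {q} lb ub = ≤-by-halves p q λ j →
  ≤-from-sum (lb (suc j) ⊕ ub (suc j) ⊕ ≤-reflexive (half-suc+half-suc j))
    (solve 5 (λ p q zs hs hj → p :+ (((zs :+ hs) :+ (q :+ hs)) :+ hj) := (q :+ hj) :+ ((p :+ zs) :+ (hs :+ hs))) refl
      p q (z (suc j)) (half (suc j)) (half j))

DistLe-weaken : ∀ {z w m m'} → m ℕ.≤ m' → DistLe z w m' → DistLe z w m
DistLe-weaken m≤m' d n = ≤-trans (d n) (+-monoˡ-≤ _ (half-antimono m≤m'))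

DistLe-all⇒≃ : ∀ {z w} → (∀ m → DistLe z w m) → z ≃ w
DistLe-all⇒≃ {z} {w} d n = ≤-by-halves _ _ λ j →
  ≤-from-sum (d j (suc n) ⊕ ≤-reflexive (half-suc+half-suc n))
    (solve 4 (λ a hj hs hn → a :+ ((hj :+ (hs :+ hs)) :+ hn) := (hn :+ hj) :+ (a :+ (hs :+ hs))) refl
      (∣ z (suc n) - w (suc n) ∣) (half j) (half (suc n)) (half n))

-- The proofs below compare the sequences at index j + 2 and let j → ∞.
lowerBound-transfer : ∀ {z w m p} → Regular w → DistLe z w m → LowerBound z p → LowerBound w (p - half m)
lowerBound-transfer {z} {w} {m} {p} reg d lb n = ≤-by-halves _ _ λ j → let J = suc (suc j) in
  ≤-from-sum (regular-≤ {w} reg J n ⊕ ∣p-q∣≤⇒≤ (z J) (w J) (d J) ⊕ lb J ⊕ ≤-reflexive (half-suc+half-suc (suc j))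
                ⊕ ≤-reflexive (half-suc+half-suc (suc j)) ⊕ ≤-reflexive (half-suc+half-suc j))
    (solve 9 (λ wn wJ zJ p hn hm hJ hsj hj → (p :- hm) :+ (((((wn :+ (hJ :+ hn)) :+ (wJ :+ (hm :+ (hJ :+ hJ)))) :+ (zJ :+ hJ)) :+ hsj) :+ hsj :+ hj)
      := ((wn :+ hn) :+ hj) :+ (((((wJ :+ zJ) :+ p) :+ (hJ :+ hJ)) :+ (hJ :+ hJ)) :+ (hsj :+ hsj))) refl
      (w n) (w J) (z J) p (half n) (half m) (half J) (half (suc j)) (half j))

upperBound-transfer : ∀ {z w m q} → Regular w → DistLe z w m → UpperBound z q → UpperBound w (q + half m)
upperBound-transfer {z} {w} {m} {q} reg d ub n = ≤-by-halves _ _ λ j → let J = suc (suc j) in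
  ≤-from-sum (regular-≤ {w} reg n J ⊕ ∣p-q∣≤⇒≥ (z J) (w J) (d J) ⊕ ub J ⊕ ≤-reflexive (half-suc+half-suc (suc j))
                ⊕ ≤-reflexive (half-suc+half-suc (suc j)) ⊕ ≤-reflexive (half-suc+half-suc j))
    (solve 9 (λ wn wJ zJ q hn hm hJ hsj hj → wn :+ (((((wJ :+ (hn :+ hJ)) :+ (zJ :+ (hm :+ (hJ :+ hJ)))) :+ (q :+ hJ)) :+ hsj) :+ hsj :+ hj)
      := (((q :+ hm) :+ hn) :+ hj) :+ (((((wn :+ wJ) :+ zJ) :+ (hJ :+ hJ)) :+ (hJ :+ hJ)) :+ (hsj :+ hsj))) refl
      (w n) (w J) (z J) q (half n) (half m) (half J) (half (suc j)) (half j))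

lowerBound-resp-≃ : ∀ {z w p} → Regular z → z ≃ w → LowerBound w p → LowerBound z p
lowerBound-resp-≃ {z} {w} {p} reg z≃w lb n = ≤-by-halves _ _ λ j → let J = suc (suc j) in
  ≤-from-sum (regular-≤ {z} reg J n ⊕ ∣p-q∣≤⇒≥ (z J) (w J) (z≃w (suc j)) ⊕ lb J ⊕ ≤-reflexive (half-suc+half-suc (suc j))
                ⊕ ≤-reflexive (half-suc+half-suc j))
    (solve 8 (λ zn zJ wJ p hn hJ hsj hj → p :+ ((((zn :+ (hJ :+ hn)) :+ (zJ :+ hsj)) :+ (wJ :+ hJ)) :+ hsj :+ hj)
      := ((zn :+ hn) :+ hj) :+ ((((zJ :+ wJ) :+ p) :+ (hJ :+ hJ)) :+ (hsj :+ hsj))) refl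
      (z n) (z J) (w J) p (half n) (half J) (half (suc j)) (half j))

upperBound-resp-≃ : ∀ {z w q} → Regular z → z ≃ w → UpperBound w q → UpperBound z q
upperBound-resp-≃ {z} {w} {q} reg z≃w ub n = ≤-by-halves _ _ λ j → let J = suc (suc j) in
  ≤-from-sum (regular-≤ {z} reg n J ⊕ ∣p-q∣≤⇒≤ (z J) (w J) (z≃w (suc j)) ⊕ ub J ⊕ ≤-reflexive (half-suc+half-suc (suc j))
                ⊕ ≤-reflexive (half-suc+half-suc j))
    (solve 8 (λ zn zJ wJ q hn hJ hsj hj → zn :+ ((((zJ :+ (hn :+ hJ)) :+ (wJ :+ hsj)) :+ (q :+ hJ)) :+ hsj :+ hj)
      := ((q :+ hn) :+ hj) :+ ((((zn :+ zJ) :+ wJ) :+ (hJ :+ hJ)) :+ (hsj :+ hsj))) refl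
      (z n) (z J) (w J) q (half n) (half J) (half (suc j)) (half j))

∈ᴵ-resp-≃ : ∀ {z w I} → Regular z → z ≃ w → w ∈ᴵ I → z ∈ᴵ I
∈ᴵ-resp-≃ {z} {w} {I} reg z≃w (lb , ub) = lowerBound-resp-≃ {z} {w} reg z≃w lb , upperBound-resp-≃ {z} {w} {proj₂ I} reg z≃w ub

∈ᴵ-DistLe : ∀ {z w I k} → z ∈ᴵ I → w ∈ᴵ I → width I ≤ half k → DistLe z w k
∈ᴵ-DistLe {z} {w} {p , q} {k} (lb-z , ub-z) (lb-w , ub-w) width≤ m = ≤⇒∣p-q∣≤ {z m} {w m}
  (≤-from-sum (ub-z m ⊕ lb-w m ⊕ width≤) (shift (z m) (w m)))
  (≤-from-sum (ub-w m ⊕ lb-z m ⊕ width≤) (shift (w m) (z m)))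
  where
  shift : ∀ a b → a + (((q + half m) + (b + half m)) + half k) ≡ (b + (half k + (half m + half m))) + ((a + p) + (q - p))
  shift a b = solve 6 (λ a b p q hk hm → a :+ (((q :+ hm) :+ (b :+ hm)) :+ hk) := (b :+ (hk :+ (hm :+ hm))) :+ ((a :+ p) :+ (q :- p)))
                refl a b p q (half k) (half m)

middle : Ter
middle = F.suc F.zero

-- Φ (pad s) is the centre of 𝕀 s.
pad : List Ter → ℕ → Ter
pad []       _       = middle
pad (i ∷ _)  zero    = i
pad (_ ∷ s)  (suc n) = pad s n

pad-init : ∀ α m i → i ℕ.< m → pad (init α m) i ≡ α i
pad-init α (suc m) zero    _           = refl
pad-init α (suc m) (suc i) (ℕ.s≤s i<m) = pad-init (λ j → α (suc j)) m i i<m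

pad-beyond : ∀ s i → length s ℕ.≤ i → pad s i ≡ middle
pad-beyond []      i       _         = refl
pad-beyond (_ ∷ s) (suc i) (ℕ.s≤s p) = pad-beyond s i p

pad-++ : ∀ s u i → i ℕ.< length s → pad (s ++ u) i ≡ pad s i
pad-++ (_ ∷ s) u zero    _         = refl
pad-++ (_ ∷ s) u (suc i) (ℕ.s≤s p) = pad-++ s u i p

pad-last : ∀ s i → pad (s ++ i ∷ []) (length s) ≡ i
pad-last []      i = refl
pad-last (_ ∷ s) i = pad-last s i

length-init : ∀ α n → length (init α n) ≡ n
length-init α n = LP.length-applyUpTo α n

length-snoc : ∀ s (i : Ter) → length (s ++ i ∷ []) ≡ suc (length s)
length-snoc s i = trans (LP.length-++ s {i ∷ []}) (NP.+-comm (length s) 1)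

init-snoc : ∀ α n → init α (suc n) ≡ init α n ++ α n ∷ []
init-snoc α n = sym (LP.applyUpTo-∷ʳ α n)

Agree : (ℕ → Ter) → (ℕ → Ter) → ℕ → Set
Agree α β m = ∀ i → i ℕ.< m → α i ≡ β i

init-cong : ∀ α β n → Agree α β n → init α n ≡ init β n
init-cong α β zero    _  = refl
init-cong α β (suc n) ag = cong₂ _∷_ (ag 0 (ℕ.s≤s ℕ.z≤n))
  (init-cong (λ i → α (suc i)) (λ i → β (suc i)) n (λ i p → ag (suc i) (ℕ.s≤s p)))

init-pad : ∀ s → init (pad s) (length s) ≡ s
init-pad []      = refl
init-pad (i ∷ s) = cong (i ∷_) (init-pad s)

N-step : ℕ → Ter → ℕ
N-step acc i = 2 ℕ.* acc ℕ.+ toℕ i ℕ.∸ 1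

N-snoc : ∀ s i → N (s ++ i ∷ []) ≡ N-step (N s) i
N-snoc s i = LP.foldl-++ N-step 1 s (i ∷ [])

toℕ≤2 : ∀ (i : Ter) → toℕ i ℕ.≤ 2
toℕ≤2 F.zero                = ℕ.z≤n
toℕ≤2 (F.suc F.zero)        = ℕ.s≤s ℕ.z≤n
toℕ≤2 (F.suc (F.suc F.zero)) = ℕ.s≤s (ℕ.s≤s ℕ.z≤n)

N-step-pos : ∀ a i → 1 ℕ.≤ a → 1 ℕ.≤ N-step a i
N-step-pos (suc b) i _ = NP.≤-trans (NP.≤-trans (ℕ.s≤s ℕ.z≤n) (NP.m≤n+m (suc (b ℕ.+ 0)) b))
  (NP.m≤m+n (b ℕ.+ suc (b ℕ.+ 0)) (toℕ i))

N-step-< : ∀ a i k → a ℕ.< 2 ℕ.^ k → N-step a i ℕ.< 2 ℕ.^ suc k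
N-step-< a i k a<2^k = NP.≤-trans (ℕ.s≤s (NP.∸-monoˡ-≤ 1 (NP.+-monoʳ-≤ (2 ℕ.* a) (toℕ≤2 i))))
  (NP.≤-trans (NP.≤-reflexive 2a+2-1+1≡2[a+1]) (NP.*-monoʳ-≤ 2 a<2^k))
  where
  2a+2-1+1≡2[a+1] : suc (2 ℕ.* a ℕ.+ 2 ℕ.∸ 1) ≡ 2 ℕ.* suc a
  2a+2-1+1≡2[a+1] = trans (cong (λ v → suc (v ℕ.∸ 1)) (NP.+-comm (2 ℕ.* a) 2)) (sym (NP.*-suc 2 a))

foldl-N-step-bounds : ∀ s a k → 1 ℕ.≤ a → a ℕ.< 2 ℕ.^ k →
                      (1 ℕ.≤ foldl N-step a s) × (foldl N-step a s ℕ.< 2 ℕ.^ (k ℕ.+ length s))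
foldl-N-step-bounds []      a k 1≤a a<2^k = 1≤a , subst (λ e → a ℕ.< 2 ℕ.^ e) (sym (NP.+-identityʳ k)) a<2^k
foldl-N-step-bounds (i ∷ s) a k 1≤a a<2^k with foldl-N-step-bounds s (N-step a i) (suc k) (N-step-pos a i 1≤a) (N-step-< a i k a<2^k)
... | pos , bound = pos , subst (λ e → foldl N-step (N-step a i) s ℕ.< 2 ℕ.^ e) (sym (NP.+-suc k (length s))) bound

N-bounds : ∀ s → (1 ℕ.≤ N s) × (N s ℕ.< 2 ℕ.^ suc (length s))
N-bounds s = foldl-N-step-bounds s 1 1 (ℕ.s≤s ℕ.z≤n) (ℕ.s≤s (ℕ.s≤s ℕ.z≤n))

digit : Ter → ℚ
digit i = ℕtoℚ (toℕ i) - 1ℚ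

∣digit∣≤1 : ∀ i → ∣ digit i ∣ ≤ 1ℚ
∣digit∣≤1 F.zero                 = ≤-refl
∣digit∣≤1 (F.suc F.zero)         = 0≤1
∣digit∣≤1 (F.suc (F.suc F.zero)) = ≤-refl

Φ-suc : ∀ α n → Φ α (suc n) ≡ Φ α n + half (2 ℕ.+ n) * digit (α n)
Φ-suc α n = begin
  half (2 ℕ.+ n) * ℕtoℚ (N (init α (suc n)))        ≡⟨ cong (λ s → half (2 ℕ.+ n) * ℕtoℚ (N s)) (init-snoc α n) ⟩
  half (2 ℕ.+ n) * ℕtoℚ (N (init α n ++ α n ∷ []))  ≡⟨ cong (λ k → half (2 ℕ.+ n) * ℕtoℚ k) (N-snoc (init α n) (α n)) ⟩
  half (2 ℕ.+ n) * ℕtoℚ (N-step a (α n))            ≡⟨ cong (half (2 ℕ.+ n) *_) N-step-ℚ ⟩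
  half (2 ℕ.+ n) * ((ℕtoℚ 2 * ℕtoℚ a + ℕtoℚ (toℕ (α n))) - 1ℚ)
    ≡⟨ solve 3 (λ h A T → (con ½ :* h) :* ((con (ℕtoℚ 2) :* A :+ T) :- con 1ℚ) := h :* A :+ (con ½ :* h) :* (T :- con 1ℚ))
         refl (half (suc n)) (ℕtoℚ a) (ℕtoℚ (toℕ (α n))) ⟩
  Φ α n + half (2 ℕ.+ n) * digit (α n)              ∎
  where
  open ≡-Reasoning
  a = N (init α n)
  1≤2a+i : 1 ℕ.≤ 2 ℕ.* a ℕ.+ toℕ (α n)
  1≤2a+i = NP.≤-trans (proj₁ (N-bounds (init α n))) (NP.≤-trans (NP.m≤m+n a (a ℕ.+ 0)) (NP.m≤m+n (2 ℕ.* a) (toℕ (α n))))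
  N-step-ℚ : ℕtoℚ (N-step a (α n)) ≡ (ℕtoℚ 2 * ℕtoℚ a + ℕtoℚ (toℕ (α n))) - 1ℚ
  N-step-ℚ = trans (ℕtoℚ-∸ (2 ℕ.* a ℕ.+ toℕ (α n)) 1 1≤2a+i)
               (cong (_- 1ℚ) (trans (ℕtoℚ-+ (2 ℕ.* a) (toℕ (α n))) (cong (_+ ℕtoℚ (toℕ (α n))) (ℕtoℚ-* 2 a))))

Φ-step : ∀ α n → ∣ Φ α n - Φ α (suc n) ∣ ≤ half (2 ℕ.+ n)
Φ-step α n = begin
  ∣ Φ α n - Φ α (suc n) ∣        ≡⟨ cong (λ v → ∣ Φ α n - v ∣) (Φ-suc α n) ⟩
  ∣ Φ α n - (Φ α n + h * d) ∣    ≡⟨ cong ∣_∣ (solve 3 (λ x h d → x :- (x :+ h :* d) := :- (h :* d)) refl (Φ α n) h d) ⟩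
  ∣ - (h * d) ∣                  ≡⟨ trans (∣-p∣≡∣p∣ (h * d)) (∣p*q∣≡∣p∣*∣q∣ h d) ⟩
  ∣ h ∣ * ∣ d ∣                  ≡⟨ cong (_* ∣ d ∣) (0≤p⇒∣p∣≡p (half-nonNeg (2 ℕ.+ n))) ⟩
  h * ∣ d ∣                      ≤⟨ *-monoˡ-≤-nonNeg h {{Q.nonNegative (half-nonNeg (2 ℕ.+ n))}} (∣digit∣≤1 (α n)) ⟩
  h * 1ℚ                         ≡⟨ *-identityʳ h ⟩
  h                              ∎
  where
  open ≤-Reasoning
  h = half (2 ℕ.+ n)
  d = digit (α n)

Φ-regular : ∀ α → Regular (Φ α)
Φ-regular α n = ≤-trans (Φ-step α n) (half-suc≤half (suc n))

Φ-inUnit : ∀ α → InUnit (Φ α)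
Φ-inUnit α n =
  *-nonNeg (half-nonNeg (suc n)) (ℕtoℚ-nonNeg (N (init α n))) ,
  ≤-trans (*-monoˡ-≤-nonNeg (half (suc n)) {{Q.nonNegative (half-nonNeg (suc n))}} (ℕtoℚ-mono (NP.<⇒≤ N<2^n+1)))
          (≤-reflexive (half*2^ (suc n)))
  where
  N<2^n+1 : N (init α n) ℕ.< 2 ℕ.^ suc n
  N<2^n+1 = subst (λ k → N (init α n) ℕ.< 2 ℕ.^ suc k) (length-init α n) (proj₂ (N-bounds (init α n)))

Φ-point : (ℕ → Ter) → UnitReal
Φ-point α = Φ α , Φ-regular α , Φ-inUnit α

Φ-close : ∀ α {m n} → m ℕ.≤ n → (Φ α n ≤ Φ α m + half (suc m)) × (Φ α m ≤ Φ α n + half (suc m))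
Φ-close α {m} m≤n with NP.m≤n⇒∃[o]m+o≡n m≤n
... | k , refl = subst (λ i → (Φ α i ≤ Φ α m + half (suc m)) × (Φ α m ≤ Φ α i + half (suc m))) (NP.+-comm k m)
  (≤-from-sum (proj₁ T ⊕ half-nonNeg (suc (k ℕ.+ m))) (drop (Φ α (k ℕ.+ m)) (Φ α m)) ,
   ≤-from-sum (proj₂ T ⊕ half-nonNeg (suc (k ℕ.+ m))) (drop (Φ α m) (Φ α (k ℕ.+ m))))
  where
  T = telescope (λ j → half (suc j)) (Φ α) (λ j → half-suc+half-suc (suc j)) (Φ-step α) m k
  drop : ∀ a b → a + ((b + (half (suc m) - half (suc (k ℕ.+ m)))) + half (suc (k ℕ.+ m))) ≡ (b + half (suc m)) + (a + 0ℚ)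
  drop a b = solve 4 (λ a b c d → a :+ ((b :+ (c :- d)) :+ d) := (b :+ c) :+ (a :+ con 0ℚ)) refl
               a b (half (suc m)) (half (suc (k ℕ.+ m)))

Φ-near : ∀ α m n → (Φ α n ≤ Φ α m + (half n + half (suc m))) × (Φ α m ≤ Φ α n + (half n + half (suc m)))
Φ-near α m n with NP.≤-total n m
... | inj₁ n≤m = ≤-trans (proj₂ (Φ-close α n≤m)) (+-monoʳ-≤ (Φ α m) half-suc-n≤) ,
                 ≤-trans (proj₁ (Φ-close α n≤m)) (+-monoʳ-≤ (Φ α n) half-suc-n≤)
  where
  half-suc-n≤ : half (suc n) ≤ half n + half (suc m)
  half-suc-n≤ = ≤-trans (half-suc≤half n) (≤-+-nonNeg (half (suc m)) (half-nonNeg (suc m)))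
... | inj₂ m≤n = ≤-trans (proj₁ (Φ-close α m≤n)) (+-monoʳ-≤ (Φ α m) half-suc-m≤) ,
                 ≤-trans (proj₂ (Φ-close α m≤n)) (+-monoʳ-≤ (Φ α n) half-suc-m≤)
  where
  half-suc-m≤ : half (suc m) ≤ half n + half (suc m)
  half-suc-m≤ = ≤-trans (≤-+-nonNeg (half n) (half-nonNeg n)) (≤-reflexive (+-comm (half (suc m)) (half n)))

Φ-agree : ∀ α β {m n} → Agree α β m → n ℕ.≤ m → Φ α n ≡ Φ β n
Φ-agree α β {n = n} ag n≤m = cong (λ s → half (suc n) * ℕtoℚ (N s)) (init-cong α β n (λ i p → ag i (NP.≤-trans p n≤m)))

Φ-eventually-middle : ∀ β m → (∀ i → m ℕ.≤ i → β i ≡ middle) → ∀ k → Φ β (k ℕ.+ m) ≡ Φ β m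
Φ-eventually-middle β m mid zero    = refl
Φ-eventually-middle β m mid (suc k) = begin
  Φ β (suc k ℕ.+ m)                          ≡⟨ Φ-suc β (k ℕ.+ m) ⟩
  Φ β (k ℕ.+ m) + h * digit (β (k ℕ.+ m))    ≡⟨ cong (λ i → Φ β (k ℕ.+ m) + h * digit i) (mid (k ℕ.+ m) (NP.m≤n+m m k)) ⟩
  Φ β (k ℕ.+ m) + h * digit middle           ≡⟨ solve 2 (λ x h → x :+ h :* (con 1ℚ :- con 1ℚ) := x) refl (Φ β (k ℕ.+ m)) h ⟩
  Φ β (k ℕ.+ m)                              ≡⟨ Φ-eventually-middle β m mid k ⟩
  Φ β m                                      ∎
  where
  open ≡-Reasoning
  h = half (2 ℕ.+ (k ℕ.+ m))

Φ-pad-close : ∀ α s → Agree α (pad s) (length s) → ∀ n → ∣ Φ (pad s) n - Φ α n ∣ ≤ half (suc (length s))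
Φ-pad-close α s ag n with NP.≤-total n (length s)
... | inj₁ n≤m = subst (λ v → ∣ v - Φ α n ∣ ≤ half (suc (length s))) (Φ-agree α (pad s) ag n≤m)
                   (subst (_≤ half (suc (length s))) (sym (cong ∣_∣ (+-inverseʳ (Φ α n)))) (half-nonNeg (suc (length s))))
... | inj₂ m≤n with NP.m≤n⇒∃[o]m+o≡n m≤n
...   | k , refl = subst (λ v → ∣ v - Φ α (length s ℕ.+ k) ∣ ≤ half (suc (length s))) (sym Φ-pad≡)
                     (≤⇒∣p-q∣≤ (proj₂ (Φ-close α m≤n)) (proj₁ (Φ-close α m≤n)))
  where
  Φ-pad≡ : Φ (pad s) (length s ℕ.+ k) ≡ Φ α (length s)
  Φ-pad≡ = trans (cong (Φ (pad s)) (NP.+-comm (length s) k))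
             (trans (Φ-eventually-middle (pad s) (length s) (pad-beyond s) k) (sym (Φ-agree α (pad s) ag NP.≤-refl)))

Agree-pad-init : ∀ α m → Agree α (pad (init α m)) (length (init α m))
Agree-pad-init α m i i<|s| = sym (pad-init α m i (subst (i ℕ.<_) (length-init α m) i<|s|))

Φ-pad-init-DistLe : ∀ α m → DistLe (Φ (pad (init α m))) (Φ α) (length (init α m))
Φ-pad-init-DistLe α m n = ≤-trans (Φ-pad-close α (init α m) (Agree-pad-init α m) n)
  (≤-trans (half-suc≤half (length (init α m))) (≤-+-nonNeg (half n + half n) (half-nonNeg n ⊕ half-nonNeg n)))

centre : List Ter → ℚ
centre s = Φ (pad s) (length s)

𝕀-init : ∀ α M → 𝕀 (init α M) ≡ (Φ α M - half (suc M) , Φ α M + half (suc M))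
𝕀-init α M rewrite length-init α M = cong₂ _,_
  (solve 2 (λ h x → h :* (x :- con 1ℚ) := h :* x :- h) refl (half (suc M)) (ℕtoℚ (N (init α M))))
  (solve 2 (λ h x → h :* (x :+ con 1ℚ) := h :* x :+ h) refl (half (suc M)) (ℕtoℚ (N (init α M))))

𝕀-centre : ∀ s → 𝕀 s ≡ (centre s - half (suc (length s)) , centre s + half (suc (length s)))
𝕀-centre s = trans (cong 𝕀 (sym (init-pad s))) (𝕀-init (pad s) (length s))

cell-lower-nonNeg : ∀ s → 0ℚ ≤ proj₁ (𝕀 s)
cell-lower-nonNeg s = *-nonNeg (half-nonNeg (suc (length s)))
  (≤-from-sum (ℕtoℚ-mono {1} {N s} (proj₁ (N-bounds s)))
    (solve 1 (λ x → con 0ℚ :+ x := (x :- con 1ℚ) :+ con 1ℚ) refl (ℕtoℚ (N s))))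

cell-upper≤1 : ∀ s → proj₂ (𝕀 s) ≤ 1ℚ
cell-upper≤1 s = begin
  h * (ℕtoℚ (N s) + 1ℚ)             ≡⟨ cong (h *_) (trans (+-comm (ℕtoℚ (N s)) 1ℚ) (sym (ℕtoℚ-suc (N s)))) ⟩
  h * ℕtoℚ (suc (N s))              ≤⟨ *-monoˡ-≤-nonNeg h {{Q.nonNegative (half-nonNeg (suc (length s)))}}
                                         (ℕtoℚ-mono (proj₂ (N-bounds s))) ⟩
  h * ℕtoℚ (2 ℕ.^ suc (length s))   ≡⟨ half*2^ (suc (length s)) ⟩
  1ℚ                                ∎
  where
  open ≤-Reasoning
  h = half (suc (length s))

cell-InT : ∀ s → InT (𝕀 s)
cell-InT s = subst InT (sym (𝕀-centre s))
  (≤-from-sum (half-nonNeg (suc (length s)) ⊕ half-nonNeg (suc (length s)))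
    (solve 2 (λ c h → (c :- h) :+ (h :+ h) := (c :+ h) :+ (con 0ℚ :+ con 0ℚ)) refl (centre s) (half (suc (length s)))))

cell-DistLe : ∀ s q → proj₁ (𝕀 s) ≤ q → q ≤ proj₂ (𝕀 s) → DistLe (Φ (pad s)) (λ _ → q) (length s)
cell-DistLe s q lo≤q q≤hi n = ≤⇒∣p-q∣≤ {Φ (pad s) n} {q}
  (≤-from-sum (proj₁ (Φ-near (pad s) (length s) n) ⊕ c-h≤q ⊕ half-nonNeg n ⊕ ≤-reflexive (half-suc+half-suc (length s)))
    (solve 6 (λ x q c h hn hs → x :+ ((((c :+ (hn :+ h)) :+ q) :+ hn) :+ hs)
       := (q :+ (hs :+ (hn :+ hn))) :+ (((x :+ (c :- h)) :+ con 0ℚ) :+ (h :+ h))) refl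
       (Φ (pad s) n) q (centre s) h (half n) (half (length s))))
  (≤-from-sum (proj₂ (Φ-near (pad s) (length s) n) ⊕ q≤c+h ⊕ half-nonNeg n ⊕ ≤-reflexive (half-suc+half-suc (length s)))
    (solve 6 (λ x q c h hn hs → q :+ ((((x :+ (hn :+ h)) :+ (c :+ h)) :+ hn) :+ hs)
       := (x :+ (hs :+ (hn :+ hn))) :+ (((c :+ q) :+ con 0ℚ) :+ (h :+ h))) refl
       (Φ (pad s) n) q (centre s) h (half n) (half (length s))))
  where
  h = half (suc (length s))
  c-h≤q : centre s - h ≤ q
  c-h≤q = subst (λ I → proj₁ I ≤ q) (𝕀-centre s) lo≤q
  q≤c+h : q ≤ centre s + h
  q≤c+h = subst (λ I → q ≤ proj₂ I) (𝕀-centre s) q≤hi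

constPoint : (q : ℚ) → 0ℚ ≤ q → q ≤ 1ℚ → UnitReal
constPoint q 0≤q q≤1 = (λ _ → q) ,
  (λ n → subst (_≤ half (suc n)) (sym (cong ∣_∣ (+-inverseʳ q))) (half-nonNeg (suc n))) ,
  (λ _ → 0≤q , q≤1)

infixl 30 _∩_
_∩_ : Interval → Interval → Interval
(p , q) ∩ (p' , q') = (p ⊔ p' , q ⊓ q')

∈ᴵ-∩ : ∀ {z} I J → z ∈ᴵ I → z ∈ᴵ J → z ∈ᴵ I ∩ J
∈ᴵ-∩ {z} (p , q) (p' , q') (lb , ub) (lb' , ub') = lower (⊔-sel p p') , upper (⊓-sel q q')
  where
  lower : (p ⊔ p' ≡ p) ⊎ (p ⊔ p' ≡ p') → LowerBound z (p ⊔ p')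
  lower (inj₁ e) rewrite e = lb
  lower (inj₂ e) rewrite e = lb'
  upper : (q ⊓ q' ≡ q) ⊎ (q ⊓ q' ≡ q') → UpperBound z (q ⊓ q')
  upper (inj₁ e) rewrite e = ub
  upper (inj₂ e) rewrite e = ub'

∩-⊑ˡ : ∀ I J → I ∩ J ⊑ I
∩-⊑ˡ (p , q) (p' , q') = p≤p⊔q p p' , p⊓q≤p q q'

∩-⊑ʳ : ∀ I J → I ∩ J ⊑ J
∩-⊑ʳ (p , q) (p' , q') = p≤q⊔p p p' , p⊓q≤q q q'

∩-monoʳ-⊑ : ∀ I {J J'} → J' ⊑ J → I ∩ J' ⊑ I ∩ J
∩-monoʳ-⊑ (p , q) (pJ≤pJ' , qJ'≤qJ) = ⊔-monoʳ-≤ p pJ≤pJ' , ⊓-monoʳ-≤ q qJ'≤qJ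

⊑-refl : ∀ I → I ⊑ I
⊑-refl (p , q) = ≤-refl , ≤-refl

⊑-trans : ∀ {I J K} → I ⊑ J → J ⊑ K → I ⊑ K
⊑-trans (p'≤p , q≤q') (p''≤p' , q'≤q'') = ≤-trans p''≤p' p'≤p , ≤-trans q≤q' q'≤q''

⊑-width : ∀ {I J} → I ⊑ J → width I ≤ width J
⊑-width {p , q} {p' , q'} (p'≤p , q≤q') = ≤-from-sum (p'≤p ⊕ q≤q')
  (solve 4 (λ p q p' q' → (q :- p) :+ (p :+ q') := (q' :- p') :+ (p' :+ q)) refl p q p' q')

width-nonNeg : ∀ {I} → InT I → 0ℚ ≤ width I
width-nonNeg {p , q} p≤q = ≤-from-sum p≤q (solve 2 (λ p q → con 0ℚ :+ q := (q :- p) :+ p) refl p q)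

nested-left-end : ∀ {I P} ε → InT I → InT P → width P ≤ ε → P ⊑ I ⊎ I ⊑ P →
                  (proj₁ I ≤ proj₁ P + ε) × (proj₁ P ≤ proj₂ I + ε)
nested-left-end {pI , qI} {pP , qP} ε pI≤qI pP≤qP width≤ (inj₁ (pI≤pP , qP≤qI)) =
  ≤-trans pI≤pP (≤-+-nonNeg ε ε-nonNeg) , ≤-trans (≤-trans pP≤qP qP≤qI) (≤-+-nonNeg ε ε-nonNeg)
  where
  ε-nonNeg : 0ℚ ≤ ε
  ε-nonNeg = ≤-trans (width-nonNeg {pP , qP} pP≤qP) width≤
nested-left-end {pI , qI} {pP , qP} ε pI≤qI pP≤qP width≤ (inj₂ (pP≤pI , qI≤qP)) =
  ≤-from-sum (pI≤qI ⊕ qI≤qP ⊕ width≤)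
    (solve 5 (λ pI qI pP qP ε → pI :+ ((qI :+ qP) :+ ε) := (pP :+ ε) :+ ((pI :+ qI) :+ (qP :- pP))) refl pI qI pP qP ε) ,
  ≤-trans (≤-trans pP≤pI pI≤qI) (≤-+-nonNeg ε (≤-trans (width-nonNeg {pP , qP} pP≤qP) width≤))

-- nothing is the unit of meet: it stands for "no information yet".
meet : Maybe Interval → Maybe Interval → Maybe Interval
meet nothing  m        = m
meet (just I) nothing  = just I
meet (just I) (just J) = just (I ∩ J)

infix 4 _⊑ᵐ_
_⊑ᵐ_ : Maybe Interval → Maybe Interval → Set
m' ⊑ᵐ m = ∀ I → m ≡ just I → Σ Interval λ I' → (m' ≡ just I') × (I' ⊑ I)

⊑ᵐ-refl : ∀ m → m ⊑ᵐ m
⊑ᵐ-refl m I e = I , e , ⊑-refl I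

⊑ᵐ-trans : ∀ {a b c} → a ⊑ᵐ b → b ⊑ᵐ c → a ⊑ᵐ c
⊑ᵐ-trans a⊑b b⊑c I e with b⊑c I e
... | J , eJ , J⊑I with a⊑b J eJ
...   | K , eK , K⊑J = K , eK , ⊑-trans K⊑J J⊑I

⊑ᵐ-just : ∀ {m' m I I'} → m' ⊑ᵐ m → m ≡ just I → m' ≡ just I' → I' ⊑ I
⊑ᵐ-just {I = I} m'⊑m m≡I m'≡I' with m'⊑m I m≡I
... | K , m'≡K , K⊑I = subst (_⊑ I) (just-injective (trans (sym m'≡K) m'≡I')) K⊑I

meet-⊑ᵐˡ : ∀ a b → meet a b ⊑ᵐ a
meet-⊑ᵐˡ (just I) nothing  .I refl = I , refl , ⊑-refl I
meet-⊑ᵐˡ (just I) (just J) .I refl = I ∩ J , refl , ∩-⊑ˡ I J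

meet-⊑ᵐʳ : ∀ a b → meet a b ⊑ᵐ b
meet-⊑ᵐʳ nothing  b = ⊑ᵐ-refl b
meet-⊑ᵐʳ (just I) (just J) .J refl = I ∩ J , refl , ∩-⊑ʳ I J

meet-monoʳ-⊑ᵐ : ∀ a {b b'} → b' ⊑ᵐ b → meet a b' ⊑ᵐ meet a b
meet-monoʳ-⊑ᵐ nothing  b'⊑b = b'⊑b
meet-monoʳ-⊑ᵐ (just I) {nothing} {nothing} _ = ⊑ᵐ-refl _
meet-monoʳ-⊑ᵐ (just I) {nothing} {just J'} _ .I refl = I ∩ J' , refl , ∩-⊑ˡ I J'
meet-monoʳ-⊑ᵐ (just I) {just J} b'⊑b .(I ∩ J) refl with b'⊑b J refl
... | J' , refl , J'⊑J = I ∩ J' , refl , ∩-monoʳ-⊑ I J'⊑J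

OnJust : (Interval → Set) → Maybe Interval → Set
OnJust P m = ∀ I → m ≡ just I → P I

meet-OnJust : ∀ {P} → (∀ I J → P I → P J → P (I ∩ J)) → ∀ a b → OnJust P a → OnJust P b → OnJust P (meet a b)
meet-OnJust P-∩ nothing  b        _  Pb = Pb
meet-OnJust P-∩ (just I) nothing  Pa _  = Pa
meet-OnJust P-∩ (just I) (just J) Pa Pb .(I ∩ J) refl = P-∩ I J (Pa I refl) (Pb J refl)

-- From a continuous modulus to a code

module CodeFromModulus (f : UnitReal → ℝ) (g : ℕ → UnitReal → ℕ)
                       (modulus : IsModulus f g) (continuous : ∀ k → PointwiseContinuous (g k)) where

  probe : List Ter → UnitReal
  probe s = Φ-point (pad s)

  fv : UnitReal → Seq
  fv y = proj₁ (f y)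

  Encloses : List Ter → Interval → Set
  Encloses s I = ∀ (y : UnitReal) → DistLe (Φ (pad s)) (proj₁ y) (length s) → fv y ∈ᴵ I

  Encloses-∩ : ∀ s I J → Encloses s I → Encloses s J → Encloses s (I ∩ J)
  Encloses-∩ s I J encI encJ y d = ∈ᴵ-∩ I J (encI y d) (encJ y d)

  Encloses-extend : ∀ t u I → Encloses t I → Encloses (t ++ u) I
  Encloses-extend t []      I enc = subst (λ s → Encloses s I) (sym (LP.++-identityʳ t)) enc
  Encloses-extend t (i ∷ u) I enc y d = enc y d'
    where
    s = t ++ i ∷ u
    |t|<|s| : suc (length t) ℕ.≤ length s
    |t|<|s| = subst (suc (length t) ℕ.≤_) (sym (LP.length-++ t {i ∷ u}))
                (subst (suc (length t) ℕ.≤_) (sym (NP.+-suc (length t) (length u))) (ℕ.s≤s (NP.m≤m+n (length t) (length u))))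
    d' : DistLe (Φ (pad t)) (proj₁ y) (length t)
    d' n = ≤-trans (∣p-r∣≤∣p-q∣+∣q-r∣ (Φ (pad t) n) (Φ (pad s) n) (proj₁ y n))
      (≤-from-sum (Φ-pad-close (pad s) t (λ j p → pad-++ t (i ∷ u) j p) n ⊕ d n
                     ⊕ half-antimono |t|<|s| ⊕ ≤-reflexive (half-suc+half-suc (length t)))
        (solve 6 (λ a b h hs hn ht → (a :+ b) :+ (((h :+ (hs :+ (hn :+ hn))) :+ h) :+ ht)
                   := (ht :+ (hn :+ hn)) :+ (((a :+ b) :+ hs) :+ (h :+ h))) refl
          (∣ Φ (pad t) n - Φ (pad s) n ∣) (∣ Φ (pad s) n - proj₁ y n ∣)
          (half (suc (length t))) (half (length s)) (half n) (half (length t))))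

  estimate : List Ter → ℕ → Interval
  estimate s k = (fv (probe s) k - (half k + half k) , fv (probe s) k + (half k + half k))

  estimate-encloses : ∀ s k → g k (probe s) ℕ.≤ length s → Encloses s (estimate s k)
  estimate-encloses s k g≤|s| y d =
    lowerBound-weaken {fv y} {(a - h) - h} (≤-reflexive (solve 2 (λ a h → a :- (h :+ h) := (a :- h) :- h) refl a h))
      (lowerBound-transfer {fv x} {fv y} {k} {a - h} (proj₂ (f y)) dist
        (lowerBound-from-term {fv x} (proj₂ (f x)) {k} {a} ≤-refl)) ,
    upperBound-weaken {fv y} {(a + h) + h} (≤-reflexive (+-assoc a h h))
      (upperBound-transfer {fv x} {fv y} {k} {a + h} (proj₂ (f y)) dist
        (upperBound-from-term {fv x} (proj₂ (f x)) {k} {a} ≤-refl))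
    where
    x = probe s
    a = fv x k
    h = half k
    dist : DistLe (fv x) (fv y) k
    dist = modulus k x y (DistLe-weaken {Φ (pad s)} {proj₁ y} g≤|s| d)

  candidateFor : ∀ s k → Dec (g k (probe s) ℕ.≤ length s) → Maybe Interval
  candidateFor s k (yes _) = just (estimate s k)
  candidateFor s k (no  _) = nothing

  candidate : List Ter → ℕ → Maybe Interval
  candidate s k = candidateFor s k (g k (probe s) ℕ.≤? length s)

  candidate-encloses : ∀ s k → OnJust (Encloses s) (candidate s k)
  candidate-encloses s k = decide (g k (probe s) ℕ.≤? length s)
    where
    decide : ∀ d → OnJust (Encloses s) (candidateFor s k d)
    decide (yes g≤|s|) _ refl = estimate-encloses s k g≤|s|

  candidate-just : ∀ s k → g k (probe s) ℕ.≤ length s → candidate s k ≡ just (estimate s k)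
  candidate-just s k g≤|s| = decide (g k (probe s) ℕ.≤? length s)
    where
    decide : ∀ d → candidateFor s k d ≡ just (estimate s k)
    decide (yes _)   = refl
    decide (no  g≰) = ⊥-elim (g≰ g≤|s|)

  meetUpTo : List Ter → ℕ → Maybe Interval
  meetUpTo s zero    = candidate s zero
  meetUpTo s (suc k) = meet (meetUpTo s k) (candidate s (suc k))

  meetUpTo-encloses : ∀ s k → OnJust (Encloses s) (meetUpTo s k)
  meetUpTo-encloses s zero    = candidate-encloses s zero
  meetUpTo-encloses s (suc k) = meet-OnJust (Encloses-∩ s) (meetUpTo s k) (candidate s (suc k))
                                  (meetUpTo-encloses s k) (candidate-encloses s (suc k))

  meetUpTo-⊑ᵐ : ∀ s {j} k → j ℕ.≤ k → meetUpTo s k ⊑ᵐ candidate s j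
  meetUpTo-⊑ᵐ s zero    ℕ.z≤n = ⊑ᵐ-refl (candidate s zero)
  meetUpTo-⊑ᵐ s {j} (suc k) j≤k+1 = split (NP.m≤n⇒m<n∨m≡n j≤k+1)
    where
    split : j ℕ.< suc k ⊎ j ≡ suc k → meetUpTo s (suc k) ⊑ᵐ candidate s j
    split (inj₂ refl)        = meet-⊑ᵐʳ (meetUpTo s k) (candidate s (suc k))
    split (inj₁ (ℕ.s≤s j≤k)) = ⊑ᵐ-trans {meetUpTo s (suc k)} {meetUpTo s k}
                                 (meet-⊑ᵐˡ (meetUpTo s k) (candidate s (suc k))) (meetUpTo-⊑ᵐ s k j≤k)

  bound : List Ter → Maybe Interval
  bound s = meetUpTo s (length s)

  meetPrefixes : List Ter → List Ter → Maybe Interval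
  meetPrefixes t []      = bound t
  meetPrefixes t (i ∷ r) = meet (bound t) (meetPrefixes (t ++ i ∷ []) r)

  φ : Code
  φ s = meetPrefixes [] s

  meetPrefixes-encloses : ∀ r t → OnJust (Encloses (t ++ r)) (meetPrefixes t r)
  meetPrefixes-encloses []      t I e = Encloses-extend t [] I (meetUpTo-encloses t (length t) I e)
  meetPrefixes-encloses (i ∷ r) t = meet-OnJust (Encloses-∩ (t ++ i ∷ r)) (bound t) (meetPrefixes (t ++ i ∷ []) r)
    (λ I e → Encloses-extend t (i ∷ r) I (meetUpTo-encloses t (length t) I e))
    (λ I e → subst (λ s → Encloses s I) (LP.++-assoc t (i ∷ []) r) (meetPrefixes-encloses r (t ++ i ∷ []) I e))

  meetPrefixes-snoc : ∀ r t i → meetPrefixes t (r ++ i ∷ []) ⊑ᵐ meetPrefixes t r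
  meetPrefixes-snoc []      t i = meet-⊑ᵐˡ (bound t) (meetPrefixes (t ++ i ∷ []) [])
  meetPrefixes-snoc (j ∷ r) t i = meet-monoʳ-⊑ᵐ (bound t) (meetPrefixes-snoc r (t ++ j ∷ []) i)

  meetPrefixes-⊑ᵐ-bound : ∀ r t → meetPrefixes t r ⊑ᵐ bound (t ++ r)
  meetPrefixes-⊑ᵐ-bound []      t = subst (λ s → meetPrefixes t [] ⊑ᵐ bound s) (sym (LP.++-identityʳ t)) (⊑ᵐ-refl (bound t))
  meetPrefixes-⊑ᵐ-bound (i ∷ r) t = ⊑ᵐ-trans {meetPrefixes t (i ∷ r)} {meetPrefixes (t ++ i ∷ []) r}
    (meet-⊑ᵐʳ (bound t) (meetPrefixes (t ++ i ∷ []) r))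
    (subst (λ s → meetPrefixes (t ++ i ∷ []) r ⊑ᵐ bound s) (LP.++-assoc t (i ∷ []) r) (meetPrefixes-⊑ᵐ-bound r (t ++ i ∷ [])))

  φ-encloses : ∀ s I → φ s ≡ just I → Encloses s I
  φ-encloses s = meetPrefixes-encloses s []

  φ-C1 : C1 φ
  φ-C1 s I e = lower≤upper {fv (probe s)} (proj₁ fx∈I) (proj₂ fx∈I)
    where
    self : DistLe (Φ (pad s)) (Φ (pad s)) (length s)
    self n = subst (_≤ half (length s) + (half n + half n)) (sym (cong ∣_∣ (+-inverseʳ (Φ (pad s) n))))
               (≤-trans (≤-reflexive (sym (+-identityʳ 0ℚ))) (half-nonNeg (length s) ⊕ ≤-trans (≤-reflexive (sym (+-identityʳ 0ℚ))) (half-nonNeg n ⊕ half-nonNeg n)))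
    fx∈I : fv (probe s) ∈ᴵ I
    fx∈I = φ-encloses s I e (probe s) self

  φ-C2 : C2 φ
  φ-C2 k α = m , I , φs≡I , width-I≤
    where
    K  = 2 ℕ.+ k
    n₀ = proj₁ (continuous K (Φ-point α))
    m  = n₀ ℕ.+ (g K (Φ-point α) ℕ.+ K)
    s  = init α m
    g-same : g K (Φ-point α) ≡ g K (probe s)
    g-same = proj₂ (continuous K (Φ-point α)) (probe s)
      (λ i i<n₀ → Φ-agree α (pad s) (Agree-pad-init α m) (NP.≤-trans (NP.<⇒≤ i<n₀)
                    (subst (n₀ ℕ.≤_) (sym (length-init α m)) (NP.m≤m+n n₀ _))))
    g≤|s| : g K (probe s) ℕ.≤ length s
    g≤|s| = subst₂ ℕ._≤_ g-same (sym (length-init α m)) (NP.≤-trans (NP.m≤m+n _ K) (NP.m≤n+m _ n₀))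
    K≤|s| : K ℕ.≤ length s
    K≤|s| = subst (K ℕ.≤_) (sym (length-init α m)) (NP.≤-trans (NP.m≤n+m K _) (NP.m≤n+m _ n₀))
    refined : Σ Interval λ I → (φ s ≡ just I) × (I ⊑ estimate s K)
    refined = ⊑ᵐ-trans {φ s} {bound s} (meetPrefixes-⊑ᵐ-bound s []) (meetUpTo-⊑ᵐ s (length s) K≤|s|)
                (estimate s K) (candidate-just s K g≤|s|)
    I = proj₁ refined
    φs≡I = proj₁ (proj₂ refined)
    a = fv (probe s) K
    h = half K
    width-estimate : width (estimate s K) ≡ half k
    width-estimate = trans (solve 2 (λ a h → (a :+ (h :+ h)) :- (a :- (h :+ h)) := (h :+ h) :+ (h :+ h)) refl a h)
      (trans (cong₂ _+_ (half-suc+half-suc (suc k)) (half-suc+half-suc (suc k))) (half-suc+half-suc k))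
    width-I≤ : width I ≤ half k
    width-I≤ = ≤-trans (⊑-width {I} {estimate s K} (proj₂ (proj₂ refined))) (≤-reflexive width-estimate)

  φ-C3 : C3 φ
  φ-C3 s i = meetPrefixes-snoc s [] i

  φ-C4 : C4 φ
  φ-C4 s t I J φs≡I φt≡J 𝕀s≈𝕀t =
    lower≤upper {fv y} (proj₁ fq∈J) (proj₂ fq∈I) , lower≤upper {fv y} (proj₁ fq∈I) (proj₂ fq∈J)
    where
    q = proj₁ (𝕀 s) ⊔ proj₁ (𝕀 t)
    q≤us : q ≤ proj₂ (𝕀 s)
    q≤us = ⊔-lub (cell-InT s) (proj₁ 𝕀s≈𝕀t)
    q≤ut : q ≤ proj₂ (𝕀 t)
    q≤ut = ⊔-lub (proj₂ 𝕀s≈𝕀t) (cell-InT t)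
    y = constPoint q (≤-trans (cell-lower-nonNeg s) (p≤p⊔q (proj₁ (𝕀 s)) (proj₁ (𝕀 t)))) (≤-trans q≤us (cell-upper≤1 s))
    fq∈I : fv y ∈ᴵ I
    fq∈I = φ-encloses s I φs≡I y (cell-DistLe s q (p≤p⊔q (proj₁ (𝕀 s)) (proj₁ (𝕀 t))) q≤us)
    fq∈J : fv y ∈ᴵ J
    fq∈J = φ-encloses t J φt≡J y (cell-DistLe t q (p≤q⊔p (proj₁ (𝕀 s)) (proj₁ (𝕀 t))) q≤ut)

  φ-isCode : IsCode φ
  φ-isCode = φ-C1 , φ-C2 , φ-C3 , φ-C4

  -- f(x) lies in every J_n, and J_{δ(n+1)} has width at most 2^{-(n+2)}.
  φ-induces : InducedBy φ f
  φ-induces α x x≡Φα h J δ _ isFT isδ n = ≤⇒∣p-q∣≤ {fx} {p}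
    (≤-from-sum (proj₂ fx∈P (suc n) ⊕ width-P≤ ⊕ half-suc≤half (suc n) ⊕ ≤-reflexive (half-suc+half-suc n))
      (solve 6 (λ fx p q hs hss hn → fx :+ ((((q :+ hs) :+ hss) :+ hs) :+ hn)
                 := (p :+ hn) :+ (((fx :+ (q :- p)) :+ hss) :+ (hs :+ hs))) refl
         fx p q (half (suc n)) (half (2 ℕ.+ n)) (half n)))
    (≤-from-sum (proj₁ fx∈P (suc n) ⊕ half-nonNeg (suc n) ⊕ ≤-reflexive (half-suc+half-suc n))
      (solve 4 (λ fx p hs hn → p :+ (((fx :+ hs) :+ hs) :+ hn) := (fx :+ hn) :+ ((p :+ con 0ℚ) :+ (hs :+ hs))) refl
         fx p (half (suc n)) (half n)))
    where
    fx∈J : ∀ j → fv x ∈ᴵ J j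
    fx∈J j = φ-encloses s (J j) (isFT j) x
      (λ i → subst (λ v → ∣ Φ (pad s) i - v ∣ ≤ half (length s) + (half i + half i)) (sym (x≡Φα i)) (Φ-pad-init-DistLe α (h j) i))
      where s = init α (h j)
    fx = fv x (suc n)
    P = J (δ (suc n))
    p = proj₁ P
    q = proj₂ P
    fx∈P = fx∈J (δ (suc n))
    width-P≤ : q - p ≤ half (2 ℕ.+ n)
    width-P≤ = proj₁ (isδ (suc n))

-- Following a point down the tree

centre-snoc : ∀ t i → centre (t ++ i ∷ []) ≡ centre t + half (2 ℕ.+ length t) * digit i
centre-snoc t i = begin
  Φ (pad t') (length t')                                 ≡⟨ cong (Φ (pad t')) (length-snoc t i) ⟩
  Φ (pad t') (suc (length t))                            ≡⟨ Φ-suc (pad t') (length t) ⟩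
  Φ (pad t') (length t) + h * digit (pad t' (length t))  ≡⟨ cong₂ (λ u v → u + h * digit v)
                                                              (Φ-agree (pad t') (pad t) (pad-++ t (i ∷ [])) NP.≤-refl) (pad-last t i) ⟩
  centre t + h * digit i                                 ∎
  where
  open ≡-Reasoning
  t' = t ++ i ∷ []
  h = half (2 ℕ.+ length t)

𝕀-snoc : ∀ t i → 𝕀 (t ++ i ∷ []) ≡ ( (centre t + half (2 ℕ.+ length t) * digit i) - half (2 ℕ.+ length t)
                                   , (centre t + half (2 ℕ.+ length t) * digit i) + half (2 ℕ.+ length t))
𝕀-snoc t i = trans (𝕀-centre (t ++ i ∷ []))
  (cong₂ (λ c n → (c - half (suc n) , c + half (suc n))) (centre-snoc t i) (length-snoc t i))

WithMargin : Seq → Interval → ℚ → Set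
WithMargin z (l , u) m = (LowerBound z (l + m) ⊎ l ≡ 0ℚ) × (UpperBound z (u - m) ⊎ u ≡ 1ℚ)

chooseDigit : ∀ {A B : Set} → Dec A → Dec B → Ter
chooseDigit (yes _) _       = F.zero
chooseDigit (no _)  (yes _) = F.suc (F.suc F.zero)
chooseDigit (no _)  (no _)  = F.suc F.zero

-- Below a cell with centre c and radius r = 2^{-(j+1)}, the child is chosen by
-- comparing the sample z_{j+5} with c ± r/4.
module DigitChoice (z : Seq) (reg : Regular z) (j : ℕ) (c : ℚ) where

  r = half (1 ℕ.+ j)
  h = half (2 ℕ.+ j)
  q = half (3 ℕ.+ j)
  μ = half (4 ℕ.+ j)
  e = half (5 ℕ.+ j)
  a = z (5 ℕ.+ j)

  lower upper : Ter → ℚ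
  lower i = (c + h * digit i) - h
  upper i = (c + h * digit i) + h

  lower-left : lower F.zero ≡ c - r
  lower-left = solve 2 (λ c r → (c :+ (con ½ :* r) :* (con (ℕtoℚ 0) :- con 1ℚ)) :- con ½ :* r := c :- r) refl c r

  upper-right : upper (F.suc (F.suc F.zero)) ≡ c + r
  upper-right = solve 2 (λ c r → (c :+ (con ½ :* r) :* (con (ℕtoℚ 2) :- con 1ℚ)) :+ con ½ :* r := c :+ r) refl c r

  μ+e≤q : μ + e ≤ q
  μ+e≤q = ≤-trans (+-monoʳ-≤ μ (half-suc≤half (4 ℕ.+ j))) (≤-reflexive (half-suc+half-suc (3 ℕ.+ j)))

  -- The sides of the chosen child that lie strictly inside its parent, with margin μ.
  Inner : Ter → Set
  Inner F.zero                 = UpperBound z (upper F.zero - μ)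
  Inner (F.suc F.zero)         = LowerBound z (lower (F.suc F.zero) + μ) × UpperBound z (upper (F.suc F.zero) - μ)
  Inner (F.suc (F.suc F.zero)) = LowerBound z (lower (F.suc (F.suc F.zero)) + μ)

  choose-inner : ∀ (d₁ : Dec (a ≤ c - q)) (d₂ : Dec (c + q ≤ a)) → Inner (chooseDigit d₁ d₂)
  choose-inner (yes a≤c-q) _ = upperBound-weaken {z} {(c - q) + e} {upper F.zero - μ}
    (≤-from-sum μ+e≤q (solve 4 (λ c r μ e → ((c :- con ½ :* (con ½ :* r)) :+ e) :+ con ½ :* (con ½ :* r)
       := (((c :+ (con ½ :* r) :* (con (ℕtoℚ 0) :- con 1ℚ)) :+ con ½ :* r) :- μ) :+ (μ :+ e)) refl c r μ e))
    (upperBound-from-term {z} reg {5 ℕ.+ j} a≤c-q)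
  choose-inner (no _) (yes c+q≤a) = lowerBound-weaken {z} {(c + q) - e}
    (≤-from-sum μ+e≤q (solve 4 (λ c r μ e → (((c :+ (con ½ :* r) :* (con (ℕtoℚ 2) :- con 1ℚ)) :- con ½ :* r) :+ μ) :+ con ½ :* (con ½ :* r)
       := ((c :+ con ½ :* (con ½ :* r)) :- e) :+ (μ :+ e)) refl c r μ e))
    (lowerBound-from-term {z} reg {5 ℕ.+ j} c+q≤a)
  choose-inner (no a≰c-q) (no c+q≰a) =
    lowerBound-weaken {z} {(c - q) - e}
      (≤-from-sum μ+e≤q (solve 4 (λ c r μ e → (((c :+ (con ½ :* r) :* (con (ℕtoℚ 1) :- con 1ℚ)) :- con ½ :* r) :+ μ) :+ con ½ :* (con ½ :* r)
         := ((c :- con ½ :* (con ½ :* r)) :- e) :+ (μ :+ e)) refl c r μ e))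
      (lowerBound-from-term {z} reg {5 ℕ.+ j} (<⇒≤ (≰⇒> a≰c-q))) ,
    upperBound-weaken {z} {(c + q) + e} {upper (F.suc F.zero) - μ}
      (≤-from-sum μ+e≤q (solve 4 (λ c r μ e → ((c :+ con ½ :* (con ½ :* r)) :+ e) :+ con ½ :* (con ½ :* r)
         := (((c :+ (con ½ :* r) :* (con (ℕtoℚ 1) :- con 1ℚ)) :+ con ½ :* r) :- μ) :+ (μ :+ e)) refl c r μ e))
      (upperBound-from-term {z} reg {5 ℕ.+ j} (<⇒≤ (≰⇒> c+q≰a)))

  child-∈ᴵ : ∀ i → Inner i → z ∈ᴵ (c - r , c + r) → z ∈ᴵ (lower i , upper i)
  child-∈ᴵ F.zero ub (lb , _) =
    subst (LowerBound z) (sym lower-left) lb ,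
    upperBound-weaken {z} {upper F.zero - μ} (-‿nonNeg-≤ {upper F.zero} μ (half-nonNeg (4 ℕ.+ j))) ub
  child-∈ᴵ (F.suc F.zero) (lb , ub) _ =
    lowerBound-weaken {z} (≤-+-nonNeg {lower (F.suc F.zero)} μ (half-nonNeg (4 ℕ.+ j))) lb ,
    upperBound-weaken {z} {upper (F.suc F.zero) - μ} (-‿nonNeg-≤ {upper (F.suc F.zero)} μ (half-nonNeg (4 ℕ.+ j))) ub
  child-∈ᴵ (F.suc (F.suc F.zero)) lb (_ , ub) =
    lowerBound-weaken {z} (≤-+-nonNeg {lower (F.suc (F.suc F.zero))} μ (half-nonNeg (4 ℕ.+ j))) lb ,
    subst (UpperBound z) (sym upper-right) ub

  child-WithMargin : ∀ i → Inner i → WithMargin z (c - r , c + r) q → WithMargin z (lower i , upper i) μ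
  child-WithMargin F.zero ub (lower-margin , _) = left-side lower-margin , inj₁ ub
    where
    left-side : LowerBound z ((c - r) + q) ⊎ c - r ≡ 0ℚ → LowerBound z (lower F.zero + μ) ⊎ lower F.zero ≡ 0ℚ
    left-side (inj₁ lb)  = inj₁ (lowerBound-weaken {z} (≤-trans (≤-reflexive (cong (_+ μ) lower-left))
                                                 (+-monoʳ-≤ (c - r) (half-suc≤half (3 ℕ.+ j)))) lb)
    left-side (inj₂ c-r≡0) = inj₂ (trans lower-left c-r≡0)
  child-WithMargin (F.suc F.zero) (lb , ub) _ = inj₁ lb , inj₁ ub
  child-WithMargin (F.suc (F.suc F.zero)) lb (_ , upper-margin) = inj₁ lb , right-side upper-margin
    where
    right-side : UpperBound z ((c + r) - q) ⊎ c + r ≡ 1ℚ →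
            UpperBound z (upper (F.suc (F.suc F.zero)) - μ) ⊎ upper (F.suc (F.suc F.zero)) ≡ 1ℚ
    right-side (inj₁ ub)  = inj₁ (upperBound-weaken {z} {(c + r) - q}
                         (≤-trans (+-monoʳ-≤ (c + r) (neg-antimono-≤ (half-suc≤half (3 ℕ.+ j))))
                                  (≤-reflexive (cong (_- μ) (sym upper-right)))) ub)
    right-side (inj₂ c+r≡1) = inj₂ (trans upper-right c+r≡1)

InCell : Seq → List Ter → Set
InCell z t = z ∈ᴵ 𝕀 t

WellInside : Seq → List Ter → Set
WellInside z t = WithMargin z (𝕀 t) (half (3 ℕ.+ length t))

nextDigit : UnitReal → List Ter → Ter
nextDigit x t = chooseDigit (a ≤? centre t - q) (centre t + q ≤? a)
  where open DigitChoice (proj₁ x) (proj₁ (proj₂ x)) (length t) (centre t)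

InCell-snoc : ∀ x t → InCell (proj₁ x) t → InCell (proj₁ x) (t ++ nextDigit x t ∷ [])
InCell-snoc x t x∈t = subst (proj₁ x ∈ᴵ_) (sym (𝕀-snoc t (chooseDigit d₁ d₂)))
  (child-∈ᴵ (chooseDigit d₁ d₂) (choose-inner d₁ d₂) (subst (proj₁ x ∈ᴵ_) (𝕀-centre t) x∈t))
  where
  open DigitChoice (proj₁ x) (proj₁ (proj₂ x)) (length t) (centre t)
  d₁ = a ≤? centre t - q
  d₂ = centre t + q ≤? a

WellInside-snoc : ∀ x t → WellInside (proj₁ x) t → WellInside (proj₁ x) (t ++ nextDigit x t ∷ [])
WellInside-snoc x t inside = subst₂ (WithMargin (proj₁ x)) (sym (𝕀-snoc t (chooseDigit d₁ d₂))) (cong (λ n → half (3 ℕ.+ n)) (sym (length-snoc t _)))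
  (child-WithMargin (chooseDigit d₁ d₂) (choose-inner d₁ d₂) (subst (λ I → WithMargin (proj₁ x) I q) (𝕀-centre t) inside))
  where
  open DigitChoice (proj₁ x) (proj₁ (proj₂ x)) (length t) (centre t)
  d₁ = a ≤? centre t - q
  d₂ = centre t + q ≤? a

InUnit-bounds : ∀ {z} → InUnit z → LowerBound z 0ℚ × UpperBound z 1ℚ
InUnit-bounds {z} z∈[0,1] =
  (λ n → ≤-trans (proj₁ (z∈[0,1] n)) (≤-+-nonNeg (half n) (half-nonNeg n))) ,
  (λ n → ≤-trans (proj₂ (z∈[0,1] n)) (≤-+-nonNeg (half n) (half-nonNeg n)))

InCell-root : ∀ (x : UnitReal) → InCell (proj₁ x) []
InCell-root x = InUnit-bounds {proj₁ x} (proj₂ (proj₂ x))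

WellInside-root : ∀ (x : UnitReal) → WellInside (proj₁ x) []
WellInside-root x = inj₂ refl , inj₂ refl

WithMargin-close : ∀ {z w} I k → Regular w → InUnit w → WithMargin z I (half k) → DistLe z w k → w ∈ᴵ I
WithMargin-close {z} {w} (l , u) k w-reg w∈[0,1] (lower-margin , upper-margin) d = lower lower-margin , upper upper-margin
  where
  lower : LowerBound z (l + half k) ⊎ l ≡ 0ℚ → LowerBound w l
  lower (inj₁ lb)  = lowerBound-weaken {w} {(l + half k) - half k} (≤-reflexive (solve 2 (λ l h → l := (l :+ h) :- h) refl l (half k)))
                       (lowerBound-transfer {z} {w} {k} w-reg d lb)
  lower (inj₂ l≡0) = subst (LowerBound w) (sym l≡0) (proj₁ (InUnit-bounds w∈[0,1]))
  upper : UpperBound z (u - half k) ⊎ u ≡ 1ℚ → UpperBound w u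
  upper (inj₁ ub)  = upperBound-weaken {w} {(u - half k) + half k} (≤-reflexive (solve 2 (λ u h → (u :- h) :+ h := u) refl u (half k)))
                       (upperBound-transfer {z} {w} {k} {u - half k} w-reg d ub)
  upper (inj₂ u≡1) = subst (UpperBound w) (sym u≡1) (proj₂ (InUnit-bounds w∈[0,1]))

∈𝕀-init-DistLe : ∀ {z} α M → z ∈ᴵ 𝕀 (init α M) → DistLe z (Φ α) M
∈𝕀-init-DistLe {z} α M z∈ n = ≤⇒∣p-q∣≤ {z n} {Φ α n}
  (≤-from-sum (ub n ⊕ proj₂ (Φ-near α M n) ⊕ ≤-reflexive (half-suc+half-suc M))
    (solve 6 (λ zn Φn c h hn hM → zn :+ ((((c :+ h) :+ hn) :+ (Φn :+ (hn :+ h))) :+ hM)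
       := (Φn :+ (hM :+ (hn :+ hn))) :+ ((zn :+ c) :+ (h :+ h))) refl
       (z n) (Φ α n) (Φ α M) (half (suc M)) (half n) (half M)))
  (≤-from-sum (proj₁ (Φ-near α M n) ⊕ lb n ⊕ ≤-reflexive (half-suc+half-suc M))
    (solve 6 (λ zn Φn c h hn hM → Φn :+ (((c :+ (hn :+ h)) :+ (zn :+ hn)) :+ hM)
       := (zn :+ (hM :+ (hn :+ hn))) :+ ((Φn :+ (c :- h)) :+ (h :+ h))) refl
       (z n) (Φ α n) (Φ α M) (half (suc M)) (half n) (half M)))
  where
  lb = proj₁ (subst (z ∈ᴵ_) (𝕀-init α M) z∈)
  ub = proj₂ (subst (z ∈ᴵ_) (𝕀-init α M) z∈)

path : UnitReal → List Ter → ℕ → List Ter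
path x s zero    = s
path x s (suc m) = path x s m ++ nextDigit x (path x s m) ∷ []

stream : UnitReal → List Ter → ℕ → Ter
stream x s i = pad (path x s (suc i)) i

length-path : ∀ x s m → length (path x s m) ≡ m ℕ.+ length s
length-path x s zero    = refl
length-path x s (suc m) = trans (length-snoc (path x s m) _) (cong suc (length-path x s m))

path-extends : ∀ x s m k → Σ (List Ter) λ u → path x s (k ℕ.+ m) ≡ path x s m ++ u
path-extends x s m zero    = [] , sym (LP.++-identityʳ _)
path-extends x s m (suc k) = proj₁ IH ++ i ∷ [] ,
  trans (cong (_++ i ∷ []) (proj₂ IH)) (LP.++-assoc (path x s m) (proj₁ IH) (i ∷ []))
  where
  IH = path-extends x s m k
  i = nextDigit x (path x s (k ℕ.+ m))

pad-path : ∀ x s m k i → i ℕ.< length (path x s m) → pad (path x s (k ℕ.+ m)) i ≡ pad (path x s m) i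
pad-path x s m k i i<|p| = trans (cong (λ p → pad p i) (proj₂ (path-extends x s m k))) (pad-++ (path x s m) _ i i<|p|)

stream-agrees : ∀ x s m → Agree (stream x s) (pad (path x s m)) (length (path x s m))
stream-agrees x s m i i<|p| = trans (sym (pad-path x s (suc i) m i i<|p[i+1]|))
  (trans (cong (λ k → pad (path x s k) i) (NP.+-comm m (suc i))) (pad-path x s m (suc i) i i<|p|))
  where
  i<|p[i+1]| : i ℕ.< length (path x s (suc i))
  i<|p[i+1]| = subst (i ℕ.<_) (sym (length-path x s (suc i))) (ℕ.s≤s (NP.m≤m+n i (length s)))

init-stream : ∀ x s m → init (stream x s) (length (path x s m)) ≡ path x s m
init-stream x s m = trans (init-cong (stream x s) (pad (path x s m)) _ (stream-agrees x s m)) (init-pad (path x s m))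

InCell-path : ∀ x s → InCell (proj₁ x) s → ∀ m → InCell (proj₁ x) (path x s m)
InCell-path x s x∈s zero    = x∈s
InCell-path x s x∈s (suc m) = InCell-snoc x (path x s m) (InCell-path x s x∈s m)

WellInside-path : ∀ x s → WellInside (proj₁ x) s → ∀ m → WellInside (proj₁ x) (path x s m)
WellInside-path x s inside zero    = inside
WellInside-path x s inside (suc m) = WellInside-snoc x (path x s m) (WellInside-path x s inside m)

stream-≃ : ∀ x s → InCell (proj₁ x) s → proj₁ x ≃ Φ (stream x s)
stream-≃ x s x∈s = DistLe-all⇒≃ {proj₁ x} {Φ (stream x s)} λ j → DistLe-weaken {proj₁ x} {Φ (stream x s)} (j≤|p| j)
  (∈𝕀-init-DistLe (stream x s) (length (path x s j)) (subst (InCell (proj₁ x)) (sym (init-stream x s j)) (InCell-path x s x∈s j)))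
  where
  j≤|p| : ∀ j → j ℕ.≤ length (path x s j)
  j≤|p| j = subst (j ℕ.≤_) (sym (length-path x s j)) (NP.m≤m+n j (length s))

least-search : (P : ℕ → Set) → (∀ n → Dec (P n)) → ∀ fuel i → (∀ m → m ℕ.< i → P m → ⊥) → P (fuel ℕ.+ i) → Σ ℕ (IsLeast P)
least-search P P? zero     i below Pi = i , Pi , below
least-search P P? (suc fuel) i below P[fuel+1+i] with P? i
... | yes Pi = i , Pi , below
... | no ¬Pi = least-search P P? fuel (suc i) below′ (subst P (sym (NP.+-suc fuel i)) P[fuel+1+i])
  where
  below′ : ∀ m → m ℕ.< suc i → P m → ⊥
  below′ m m<1+i Pm with NP.m≤n⇒m<n∨m≡n (NP.≤-pred m<1+i)
  ... | inj₁ m<i  = below m m<i Pm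
  ... | inj₂ refl = ¬Pi Pm

least : (P : ℕ → Set) → (∀ n → Dec (P n)) → ∀ b → P b → Σ ℕ (IsLeast P)
least P P? b Pb = least-search P P? b 0 (λ _ ()) (subst P (sym (NP.+-identityʳ b)) Pb)

IsLeast-unique : ∀ {P Q : ℕ → Set} {a b} → IsLeast P a → IsLeast Q b →
                 (∀ m → m ℕ.≤ a → P m → Q m) → (∀ m → m ℕ.≤ a → Q m → P m) → a ≡ b
IsLeast-unique {a = a} {b} (Pa , below-a) (Qb , below-b) P⇒Q Q⇒P with NP.<-cmp a b
... | tri< a<b _ _ = ⊥-elim (below-b a a<b (P⇒Q a NP.≤-refl Pa))
... | tri≈ _ a≡b _ = a≡b
... | tri> _ _ b<a = ⊥-elim (below-a b b<a (Q⇒P b (NP.<⇒≤ b<a) Qb))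

-- From a code to a continuous modulus

module ModulusFromCode (f : UnitReal → ℝ) (resp : Respects f) (φ : Code) (φ-code : IsCode φ) (induced : InducedBy φ f) where

  fv : UnitReal → Seq
  fv y = proj₁ (f y)

  φ-C1 : C1 φ
  φ-C1 = proj₁ φ-code

  φ-C2 : C2 φ
  φ-C2 = proj₁ (proj₂ φ-code)

  φ-C3 : C3 φ
  φ-C3 = proj₁ (proj₂ (proj₂ φ-code))

  Fine? : ∀ s k → Dec (Fine φ s k)
  Fine? s k = decide (φ s) refl
    where
    decide : ∀ m → φ s ≡ m → Dec (Fine φ s k)
    decide nothing  φs≡nothing = no λ (_ , φs≡I , _) → case trans (sym φs≡I) φs≡nothing of λ ()
    decide (just I) φs≡I = map′ (λ w → I , φs≡I , w)
      (λ (I' , φs≡I' , w') → subst (λ K → width K ≤ half k) (just-injective (trans (sym φs≡I') φs≡I)) w')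
      (width I ≤? half k)

  hLeast : ∀ α k → Σ ℕ (IsLeast (λ n → Fine φ (init α n) k))
  hLeast α k = least (λ n → Fine φ (init α n) k) (λ n → Fine? (init α n) k) (proj₁ (φ-C2 k α)) (proj₂ (φ-C2 k α))

  h : (ℕ → Ter) → ℕ → ℕ
  h α k = proj₁ (hLeast α k)

  J : (ℕ → Ter) → ℕ → Interval
  J α k = proj₁ (proj₁ (proj₂ (hLeast α k)))

  J-isFT : ∀ α → IsFT φ α (h α) (J α)
  J-isFT α k = proj₁ (proj₂ (proj₁ (proj₂ (hLeast α k))))

  J-width : ∀ α k → width (J α k) ≤ half k
  J-width α k = proj₂ (proj₂ (proj₁ (proj₂ (hLeast α k))))

  δLeast : ∀ α k → Σ ℕ (IsLeast (λ n → width (J α n) ≤ half (suc k)))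
  δLeast α k = least (λ n → width (J α n) ≤ half (suc k)) (λ n → width (J α n) ≤? half (suc k)) (suc k) (J-width α (suc k))

  δ : (ℕ → Ter) → ℕ → ℕ
  δ α k = proj₁ (δLeast α k)

  φ-init-⊑ᵐ : ∀ β {a b} → a ℕ.≤ b → φ (init β b) ⊑ᵐ φ (init β a)
  φ-init-⊑ᵐ β {a} a≤b with NP.m≤n⇒∃[o]m+o≡n a≤b
  ... | k , refl = subst (λ n → φ (init β n) ⊑ᵐ φ (init β a)) (NP.+-comm k a) (along k)
    where
    along : ∀ k → φ (init β (k ℕ.+ a)) ⊑ᵐ φ (init β a)
    along zero    = ⊑ᵐ-refl (φ (init β a))
    along (suc k) = ⊑ᵐ-trans {φ (init β (suc k ℕ.+ a))} {φ (init β (k ℕ.+ a))}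
      (subst (λ s → φ s ⊑ᵐ φ (init β (k ℕ.+ a))) (sym (init-snoc β (k ℕ.+ a))) (φ-C3 (init β (k ℕ.+ a)) (β (k ℕ.+ a))))
      (along k)

  φ-init-nested : ∀ β a b {I P} → φ (init β a) ≡ just I → φ (init β b) ≡ just P → P ⊑ I ⊎ I ⊑ P
  φ-init-nested β a b {I} {P} φa≡I φb≡P with NP.≤-total a b
  ... | inj₁ a≤b = inj₁ (⊑ᵐ-just (φ-init-⊑ᵐ β a≤b) φa≡I φb≡P)
  ... | inj₂ b≤a = inj₂ (⊑ᵐ-just (φ-init-⊑ᵐ β b≤a) φb≡P φa≡I)

  determined-∈ᴵ : ∀ β L {I} → φ (init β L) ≡ just I → determined (J β) (δ β) ∈ᴵ I
  determined-∈ᴵ β L {I} φ≡I = (λ n → proj₁ (close n)) , (λ n → proj₂ (close n))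
    where
    close : ∀ n → (proj₁ I ≤ proj₁ (J β (δ β n)) + half n) × (proj₁ (J β (δ β n)) ≤ proj₂ I + half n)
    close n = nested-left-end (half n) (φ-C1 (init β L) I φ≡I) (φ-C1 (init β (h β (δ β n))) (J β (δ β n)) (J-isFT β (δ β n)))
      (≤-trans (proj₁ (proj₂ (δLeast β n))) (half-suc≤half n))
      (φ-init-nested β L (h β (δ β n)) φ≡I (J-isFT β (δ β n)))

  f-∈ᴵ-φ : ∀ z t {I} → φ t ≡ just I → InCell (proj₁ z) t → fv z ∈ᴵ I
  f-∈ᴵ-φ z t {I} φt≡I z∈t = ∈ᴵ-resp-≃ {fv z} {fv (Φ-point β)} {I} (proj₂ (f z)) (resp z (Φ-point β) (stream-≃ z t z∈t))
    (∈ᴵ-resp-≃ {fv (Φ-point β)} {determined (J β) (δ β)} {I} (proj₂ (f (Φ-point β)))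
      (induced β (Φ-point β) (λ _ → refl) (h β) (J β) (δ β) (λ k → proj₂ (hLeast β k)) (J-isFT β) (λ k → proj₂ (δLeast β k)))
      (determined-∈ᴵ β (length t) (subst (λ s → φ s ≡ just I) (sym (init-stream z t 0)) φt≡I)))
    where β = stream z t

  digits : UnitReal → ℕ → Ter
  digits x = stream x []

  init-digits : ∀ x n → init (digits x) n ≡ path x [] n
  init-digits x n = trans (cong (init (digits x)) (sym (trans (length-path x [] n) (NP.+-identityʳ n)))) (init-stream x [] n)

  g : ℕ → UnitReal → ℕ
  g k x = 3 ℕ.+ h (digits x) k

  g-modulus : IsModulus f g
  g-modulus k x y d = ∈ᴵ-DistLe {fv x} {fv y} {J (digits x) k} {k} (f-∈ᴵ-φ x t (J-isFT (digits x) k) x∈t)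
    (f-∈ᴵ-φ y t (J-isFT (digits x) k) y∈t) (J-width (digits x) k)
    where
    m = h (digits x) k
    t = init (digits x) m
    |t| = length-init (digits x) m
    x∈t : InCell (proj₁ x) t
    x∈t = subst (InCell (proj₁ x)) (sym (init-digits x m)) (InCell-path x [] (InCell-root x) m)
    y∈t : InCell (proj₁ y) t
    y∈t = WithMargin-close (𝕀 t) (3 ℕ.+ length t) (proj₁ (proj₂ y)) (proj₂ (proj₂ y))
      (subst (WellInside (proj₁ x)) (sym (init-digits x m)) (WellInside-path x [] (WellInside-root x) m))
      (subst (λ n → DistLe (proj₁ x) (proj₁ y) (3 ℕ.+ n)) (sym |t|) d)

  g-continuous : ∀ k → PointwiseContinuous (g k)
  g-continuous k x = 5 ℕ.+ n , λ y agree → cong (3 ℕ.+_) (h-same y agree)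
    where
    n = h (digits x) k
    module _ (y : UnitReal) (agree : AgreeUpTo (proj₁ x) (proj₁ y) (5 ℕ.+ n)) where
      path-same : ∀ m → m ℕ.≤ n → path x [] m ≡ path y [] m
      path-same zero    _      = refl
      path-same (suc m) m+1≤n = cong₂ (λ u i → u ++ i ∷ []) p≡
          (trans (cong (λ a → chooseDigit (a ≤? centre p - half (3 ℕ.+ length p)) (centre p + half (3 ℕ.+ length p) ≤? a))
                       (agree (5 ℕ.+ length p) sample<))
                 (cong (nextDigit y) p≡))
        where
        p = path x [] m
        p≡ = path-same m (NP.<⇒≤ m+1≤n)
        sample< : 5 ℕ.+ length p ℕ.< 5 ℕ.+ n
        sample< = subst (λ l → 5 ℕ.+ l ℕ.< 5 ℕ.+ n) (sym (trans (length-path x [] m) (NP.+-identityʳ m))) (NP.+-monoʳ-< 5 m+1≤n)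
      init-same : ∀ j → j ℕ.≤ n → init (digits x) j ≡ init (digits y) j
      init-same j j≤n = init-cong (digits x) (digits y) j
        (λ i i<j → cong (λ p → pad p i) (path-same (suc i) (NP.<-≤-trans i<j j≤n)))
      h-same : h (digits x) k ≡ h (digits y) k
      h-same = IsLeast-unique (proj₂ (hLeast (digits x) k)) (proj₂ (hLeast (digits y) k))
        (λ m m≤n F → subst (λ s → Fine φ s k) (init-same m m≤n) F)
        (λ m m≤n F → subst (λ s → Fine φ s k) (sym (init-same m m≤n)) F)

  continuous-modulus : HasContinuousModulus f
  continuous-modulus = g , g-modulus , g-continuous

theorem6p8 : (f : UnitReal → ℝ) → Respects f →
    HasContinuousModulus f ⇔ Σ Code (λ φ → IsCode φ × InducedBy φ f)
theorem6p8 f resp = mk⇔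
  (λ (g , modulus , continuous) → let open CodeFromModulus f g modulus continuous in φ , φ-isCode , φ-induces)
  (λ (φ , φ-code , induced) → ModulusFromCode.continuous-modulus f resp φ φ-code induced)
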